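{- Let $n=2m+1\ge 3$. The following subcubes of $\{0,1\}^n$ form a tight irreducible subcube partition of size $\Theta(n^3)$: the point $0^n$; all cyclic rotations of $0^m1*^m$; and, for every $0\le i,j,k\le m-1$ with $i+j\le m-1$ and $j+k\le m-1$, the subcube $0^i1*^j0^k1*^{m-1-j-k}0^j1*^{m-1-i-j}$.
   Context: Subcubes of $\{0,1\}^n$ are identified with words in $\{0,1,*\}^n$ (a $*$ at position $i$ means coordinate $i$ is free; exponents denote repetition, e.g. $0^m$ is $m$ zeros). A subcube partition of length $n$ is a partition of $\{0,1\}^n$ into subcubes; its size is the number of subcubes. It is irreducible if no subset $G$ with $1<|G|<|F|$ has a union that is a subcube. It is tight if for every $i\in[n]$ some subcube $s$ in it has $s_i\ne *$. -}

module Defs where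

open import Data.Nat using (ℕ; zero; suc; _+_; _*_; _∸_; _^_; _≤_; _<_)
open import Data.Bool using (Bool; true; false)
open import Data.List using (List; []; _∷_; _++_; replicate; length; map; concatMap; upTo; drop; take; lookup)
open import Data.List.Relation.Unary.All using (All)
open import Data.List.Membership.Propositional using (_∈_)
open import Data.Vec using (Vec; toList)
open import Data.Fin using (Fin; toℕ)
open import Data.Fin.Subset using (Subset; _∈_; ∣_∣)
open import Data.Product using (Σ; ∃; _×_)
open import Data.Unit using (⊤)
open import Data.Empty using (⊥)
open import Relation.Binary.PropositionalEquality using (_≡_; _≢_)
open import Function.Bundles using (_⇔_)

data Sym : Set where
  O I S : Sym

-- A subcube word is a list of symbols; it is a subcube of {0,1}^n iff its length is n.
Word : Set
Word = List Sym

Match : Bool → Sym → Set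
Match false O = ⊤
Match true  I = ⊤
Match _     S = ⊤
Match _     _ = ⊥

Mem : List Bool → Word → Set
Mem []       []       = ⊤
Mem (b ∷ bs) (c ∷ cs) = Match b c × Mem bs cs
Mem _        _        = ⊥

_∈ᶜ_ : ∀ {n} → Vec Bool n → Word → Set
x ∈ᶜ s = Mem (toList x) s

Fixed : Word → ℕ → Set
Fixed []      _       = ⊥
Fixed (c ∷ _) zero    = c ≢ S
Fixed (_ ∷ cs) (suc i) = Fixed cs i

-- A list F of subcubes of {0,1}^n is a subcube partition: each has length n,
-- and every point of {0,1}^n lies in exactly one entry of the list
-- (counted with multiplicity, so entries are also pairwise distinct).
IsSubcubePartition : (n : ℕ) → List Word → Set
IsSubcubePartition n F =
  All (λ s → length s ≡ n) F ×
  ((x : Vec Bool n) → Σ (Fin (length F)) λ p →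
     (x ∈ᶜ lookup F p) × ((q : Fin (length F)) → x ∈ᶜ lookup F q → q ≡ p))

size : List Word → ℕ
size = length

UnionIsSubcube : (n : ℕ) (F : List Word) → Subset (length F) → Set
UnionIsSubcube n F G =
  Σ Word λ s → (length s ≡ n) ×
    ((x : Vec Bool n) → (x ∈ᶜ s) ⇔ (Σ (Fin (length F)) λ p → (p Data.Fin.Subset.∈ G) × (x ∈ᶜ lookup F p)))

Irreducible : (n : ℕ) → List Word → Set
Irreducible n F =
  (G : Subset (length F)) → 1 < ∣ G ∣ → ∣ G ∣ < length F → UnionIsSubcube n F G → ⊥

Tight : (n : ℕ) → List Word → Set
Tight n F = (i : Fin n) → Σ Word λ s → (s Data.List.Membership.Propositional.∈ F) × Fixed s (toℕ i)

rotate : ℕ → Word → Word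
rotate r w = drop r w ++ take r w

baseWord : ℕ → Word
baseWord m = replicate m O ++ I ∷ replicate m S

rotations : ℕ → List Word
rotations m = map (λ r → rotate r (baseWord m)) (upTo (suc (2 * m)))

tripleWord : ℕ → ℕ → ℕ → ℕ → Word
tripleWord m i j k =
  replicate i O ++ I ∷ replicate j S ++
  replicate k O ++ I ∷ replicate (m ∸ 1 ∸ j ∸ k) S ++
  replicate j O ++ I ∷ replicate (m ∸ 1 ∸ i ∸ j) S

-- All 0 ≤ i,j,k ≤ m-1 with i+j ≤ m-1 and j+k ≤ m-1:
-- i < m, j < m - i, k < m - j.
triples : ℕ → List Word
triples m =
  concatMap (λ i → concatMap (λ j → map (λ k → tripleWord m i j k)
    (upTo (m ∸ j))) (upTo (m ∸ i))) (upTo m)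

family : ℕ → List Word
family m = replicate (suc (2 * m)) O ∷ rotations m ++ triples m

-- Each member of the family is described by a predicate on points: 0^n by the zero point; the
-- rotation with its 1 at t by a 1 at t preceded cyclically by m zeros; the triple word (i, j, k)
-- by its first 1 sitting at i, the first 1 from i + j + 1 on at i + j + k + 1, and the first 1
-- from i + m + 1 on at i + m + j + 1. Searching for these first ones puts every point in a
-- member, and the predicates are pairwise exclusive, so the family is a partition (the zero word
-- alone makes it tight).
--
-- Irreducibility: let the members G have a subcube s as union, and let a ∈ G contain the corner
-- of s (its stars read as 0). If a keeps every star of s, then s ⊆ a and G = {a}. Otherwise raise
-- the corner at a star c of s that a fixes: the new point lies in some b ∈ G whose ones are those
-- of a together with c. Members have 0, 1 or 3 ones, so a = 0^n and b is the rotation with its 1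
-- at c; as b agrees with s where s is fixed, the m positions following c are stars of s. Thus
-- every star of s is followed by a star, s is the whole cube and G is the whole family.
--
-- There are 1 + n + Σ_{i<m} Σ_{j<m-i} (m - j) members, between n³/64 and 64 n³.

module Submission where

open import Defs
open import Data.Nat using (ℕ; zero; suc; _+_; _*_; _∸_; _^_; _≤_; _<_; z≤n; s≤s; s≤s⁻¹; _≤?_; _<?_; _≟_)
open import Data.Nat.Properties
open import Data.Nat.Tactic.RingSolver using (solve-∀)
open import Data.Nat.ListAction using (sum)
open import Data.Bool using (Bool; true; false)
open import Data.List using (List; []; _∷_; _++_; replicate; length; map; concatMap; upTo; lookup; drop; take)
open import Data.List.Properties
  using (length-++; length-replicate; length-map; length-upTo; ++-assoc; ++-identityʳ; take++drop≡id; map-cong; map-applyUpTo)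
open import Data.List.Membership.Propositional using (_∈_; find; lose)
open import Data.List.Membership.Propositional.Properties
  using (∈-map⁻; ∈-map⁺; ∈-++⁻; ∈-++⁺ˡ; ∈-++⁺ʳ; ∈-concatMap⁻; ∈-concatMap⁺; ∈-upTo⁻; ∈-upTo⁺; ∈-lookup)
open import Data.List.Relation.Unary.Any as Any using (here; there)
open import Data.List.Relation.Unary.Any.Properties using (lookup-index)
import Data.List.Relation.Unary.All as All
import Data.List.Relation.Unary.All.Properties as All
open import Data.List.Relation.Unary.AllPairs using ([]; _∷_)
open import Data.List.Relation.Unary.Unique.Propositional using (Unique)
import Data.List.Relation.Unary.Unique.Propositional.Properties as Unique
open import Data.Vec using (Vec; toList; tabulate)
open import Data.Vec.Properties using (length-toList)
open import Data.Fin using (Fin; toℕ)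
open import Data.Fin.Properties using (toℕ<n)
open import Data.Fin.Subset using (Subset; ⁅_⁆; ∣_∣) renaming (_∈_ to _∈ˢ_; _⊆_ to _⊆ˢ_; ⊤ to full)
open import Data.Fin.Subset.Properties using (x∈⁅x⁆; ∣⁅x⁆∣≡1; p⊆q⇒∣p∣≤∣q∣; ∣⊤∣≡n)
open import Data.Product using (Σ; _×_; _,_; proj₁; proj₂)
open import Data.Sum using (_⊎_; inj₁; inj₂)
open import Data.Unit using (⊤; tt)
open import Data.Empty using (⊥; ⊥-elim)
open import Function.Bundles using (_⇔_; mk⇔; Equivalence)
open import Relation.Nullary using (¬_; Dec; yes; no; ¬?; _×-dec_)
open import Relation.Binary.Definitions using (tri<; tri≈; tri>)
open import Relation.Binary.PropositionalEquality

≤-of-+ : ∀ a b {c} → a + b ≡ c → a ≤ c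
≤-of-+ a b refl = m≤m+n a b

<-of-+ : ∀ a b {c} → suc (a + b) ≡ c → a < c
<-of-+ a b refl = s≤s (m≤m+n a b)

+-cancelʳ-mod : ∀ {a b r c n} → a < n → b < n →
                (a + r ≡ c ⊎ a + r ≡ c + n) → (b + r ≡ c ⊎ b + r ≡ c + n) → a ≡ b
+-cancelʳ-mod {a} {b} {r}         _   _   (inj₁ e) (inj₁ e′) = +-cancelʳ-≡ r a b (trans e (sym e′))
+-cancelʳ-mod {a} {b} {r}         _   _   (inj₂ e) (inj₂ e′) = +-cancelʳ-≡ r a b (trans e (sym e′))
+-cancelʳ-mod {a} {b} {r} {c} {n} _   b<n (inj₁ e) (inj₂ e′) = ⊥-elim (<⇒≱ b<n (subst (n ≤_) (sym b≡a+n) (m≤n+m n a)))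
  where
  b≡a+n : b ≡ a + n
  b≡a+n = +-cancelʳ-≡ r b (a + n) (trans e′ (trans (cong (_+ n) (sym e)) (+-comm-mid a r n)))
    where
    +-comm-mid : ∀ a r n → a + r + n ≡ a + n + r
    +-comm-mid = solve-∀
+-cancelʳ-mod a<n b<n (inj₂ e) (inj₁ e′) = sym (+-cancelʳ-mod b<n a<n (inj₁ e′) (inj₂ e))

<∸⇒+< : ∀ {a b m} → a < m → b < m ∸ a → a + b < m
<∸⇒+< {a} {b} {m} a<m b<m∸a = subst (_< m) (+-comm b a) (subst (b + a <_) (m∸n+n≡m (<⇒≤ a<m)) (+-monoˡ-< a b<m∸a))

+<⇒<∸ : ∀ a b {m} → a + b < m → b < m ∸ a
+<⇒<∸ a b {m} lt = m+n≤o⇒m≤o∸n (suc b) (subst (_≤ m) (cong suc (+-comm a b)) lt)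

climb : ∀ {P : ℕ → Set} {n} → (∀ c → suc c ≤ n → P c → P (suc c)) → ∀ a k → a + k ≤ n → P a → P (a + k)
climb {P} step a zero    _       Pa = subst P (sym (+-identityʳ a)) Pa
climb {P} {n} step a (suc k) a+k+1≤n Pa = subst P (sym (+-suc a k))
  (step (a + k) (subst (_≤ n) (+-suc a k) a+k+1≤n) (climb step a k (≤-trans (+-monoʳ-≤ a (n≤1+n k)) a+k+1≤n) Pa))

cyclic-spread : ∀ {P : ℕ → Set} n → (∀ c → suc c ≤ n → P c → P (suc c)) → (P n → P 0) →
                ∀ c → c ≤ n → P c → ∀ d → d ≤ n → P d
cyclic-spread {P} n step wrap c c≤n Pc d d≤n = climb step 0 d d≤n (wrap Pn)
  where
  Pn : P n
  Pn = subst P (m+[n∸m]≡n c≤n) (climb step c (n ∸ c) (≤-reflexive (m+[n∸m]≡n c≤n)) Pc)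

replicate-+ : ∀ {A : Set} a b (c : A) → replicate (a + b) c ≡ replicate a c ++ replicate b c
replicate-+ zero    b c = refl
replicate-+ (suc a) b c = cong (c ∷_) (replicate-+ a b c)

drop-length-++ : ∀ {A : Set} (xs ys : List A) → drop (length xs) (xs ++ ys) ≡ ys
drop-length-++ []       ys = refl
drop-length-++ (x ∷ xs) ys = drop-length-++ xs ys

take-length-++ : ∀ {A : Set} (xs ys : List A) → take (length xs) (xs ++ ys) ≡ xs
take-length-++ []       ys = refl
take-length-++ (x ∷ xs) ys = cong (x ∷_) (take-length-++ xs ys)

rotate-++ : ∀ xs ys → rotate (length xs) (xs ++ ys) ≡ ys ++ xs
rotate-++ xs ys = cong₂ _++_ (drop-length-++ xs ys) (take-length-++ xs ys)

length-rotate : ∀ r (w : Word) → length (rotate r w) ≡ length w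
length-rotate r w = begin
  length (drop r w ++ take r w)           ≡⟨ length-++ (drop r w) ⟩
  length (drop r w) + length (take r w)   ≡⟨ +-comm (length (drop r w)) _ ⟩
  length (take r w) + length (drop r w)   ≡⟨ sym (length-++ (take r w)) ⟩
  length (take r w ++ drop r w)           ≡⟨ cong length (take++drop≡id r w) ⟩
  length w                                ∎
  where open ≡-Reasoning

length-replicate-++ : ∀ {A : Set} {c : A} a w → length (replicate a c ++ w) ≡ a + length w
length-replicate-++ zero    w = refl
length-replicate-++ (suc a) w = cong suc (length-replicate-++ a w)

Unique-map⁺ : ∀ {A B : Set} {f : A → B} {xs} →
  (∀ {x y} → x ∈ xs → y ∈ xs → f x ≡ f y → x ≡ y) → Unique xs → Unique (map f xs)
Unique-map⁺ inj [] = []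
Unique-map⁺ inj (x∉xs ∷ xs!) =
  All.map⁺ (All.tabulate λ y∈xs fx≡fy → All.lookup x∉xs y∈xs (inj (here refl) (there y∈xs) fx≡fy)) ∷
  Unique-map⁺ (λ x∈ y∈ → inj (there x∈) (there y∈)) xs!

Unique-concatMap⁺ : ∀ {A B : Set} {g : A → List B} {xs} → Unique xs → (∀ {x} → x ∈ xs → Unique (g x)) →
  (∀ {x y z} → x ∈ xs → y ∈ xs → z ∈ g x → z ∈ g y → x ≡ y) → Unique (concatMap g xs)
Unique-concatMap⁺ [] _ _ = []
Unique-concatMap⁺ {g = g} {x ∷ xs} (x∉xs ∷ xs!) g! shared =
  Unique.++⁺ (g! (here refl)) (Unique-concatMap⁺ xs! (λ y∈ → g! (there y∈)) (λ x∈ y∈ → shared (there x∈) (there y∈)))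
    λ (z∈gx , z∈rest) → let y , y∈xs , z∈gy = find (∈-concatMap⁻ g {xs = xs} z∈rest)
                        in All.lookup x∉xs y∈xs (shared (here refl) (there y∈xs) z∈gx z∈gy)

Unique-lookup-injective : ∀ {A : Set} {xs : List A} → Unique xs → ∀ p q → lookup xs p ≡ lookup xs q → p ≡ q
Unique-lookup-injective (_    ∷ _)   Fin.zero    Fin.zero    _  = refl
Unique-lookup-injective (x∉xs ∷ _)   Fin.zero    (Fin.suc q) eq = ⊥-elim (All.lookup x∉xs (∈-lookup q) eq)
Unique-lookup-injective (x∉xs ∷ _)   (Fin.suc p) Fin.zero    eq = ⊥-elim (All.lookup x∉xs (∈-lookup p) (sym eq))
Unique-lookup-injective (_    ∷ xs!) (Fin.suc p) (Fin.suc q) eq = cong Fin.suc (Unique-lookup-injective xs! p q eq)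

length-concatMap : ∀ {A B : Set} (g : A → List B) xs → length (concatMap g xs) ≡ sum (map (λ x → length (g x)) xs)
length-concatMap g []       = refl
length-concatMap g (x ∷ xs) = trans (length-++ (g x)) (cong (length (g x) +_) (length-concatMap g xs))

sum-map-mono : ∀ {A : Set} {f g : A → ℕ} xs → (∀ x → f x ≤ g x) → sum (map f xs) ≤ sum (map g xs)
sum-map-mono []       _   = z≤n
sum-map-mono (x ∷ xs) f≤g = +-mono-≤ (f≤g x) (sum-map-mono xs f≤g)

sum-map-*ˡ : ∀ {A : Set} c (f : A → ℕ) xs → sum (map (λ x → c * f x) xs) ≡ c * sum (map f xs)
sum-map-*ˡ c f []       = sym (*-zeroʳ c)
sum-map-*ˡ c f (x ∷ xs) = trans (cong (c * f x +_) (sum-map-*ˡ c f xs)) (sym (*-distribˡ-+ c (f x) _))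

sum-map-≤ : ∀ {A : Set} {f : A → ℕ} b xs → (∀ x → f x ≤ b) → sum (map f xs) ≤ length xs * b
sum-map-≤ b []       _   = z≤n
sum-map-≤ b (x ∷ xs) f≤b = +-mono-≤ (f≤b x) (sum-map-≤ b xs f≤b)

-- Points and subcubes

-- Points of {0,1}^n are modelled as functions ℕ → Bool; only the first n values matter.
Point : Set
Point = ℕ → Bool

shift : ℕ → Point → Point
shift a f q = f (a + q)

at : Word → ℕ → Sym
at []       _       = S
at (c ∷ _)  zero    = c
at (_ ∷ cs) (suc d) = at cs d

infix 4 _∈ʷ_

_∈ʷ_ : Point → Word → Set
f ∈ʷ w = ∀ d → d < length w → Match (f d) (at w d)

Characterises : (Point → Set) → Word → Set
Characterises P w = ∀ f → f ∈ʷ w ⇔ P f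

Zeros : ℕ → Point → Set
Zeros a f = ∀ q → q < a → f q ≡ false

FirstTrue : Point → ℕ → Set
FirstTrue f a = f a ≡ true × Zeros a f

match-S : ∀ b → Match b S
match-S false = tt
match-S true  = tt

match-O : ∀ {b} → Match b O → b ≡ false
match-O {false} _ = refl

match-I : ∀ {b} → Match b I → b ≡ true
match-I {true} _ = refl

false-O : ∀ {b} → b ≡ false → Match b O
false-O refl = tt

true-I : ∀ {b} → b ≡ true → Match b I
true-I refl = tt

true≢false : true ≢ false
true≢false ()

clash : ∀ {b} → b ≡ true → b ≡ false → ⊥
clash b≡true b≡false = true≢false (trans (sym b≡true) b≡false)

I⇒≢S : ∀ {x} → x ≡ I → x ≢ S
I⇒≢S refl ()

O⇒≢S : ∀ {x} → x ≡ O → x ≢ S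
O⇒≢S refl ()

≢O≢S⇒I : ∀ {x} → x ≢ O → x ≢ S → x ≡ I
≢O≢S⇒I {O} x≢O _ = ⊥-elim (x≢O refl)
≢O≢S⇒I {I} _   _ = refl
≢O≢S⇒I {S} _ x≢S = ⊥-elim (x≢S refl)

_≟S : (x : Sym) → Dec (x ≡ S)
O ≟S = no λ ()
I ≟S = no λ ()
S ≟S = yes refl

at-replicate : ∀ n (c : Sym) d → d < n → at (replicate n c) d ≡ c
at-replicate (suc n) c zero    _         = refl
at-replicate (suc n) c (suc d) (s≤s d<n) = at-replicate n c d d<n

∈ʷ-resp-≗ : ∀ {f g} w → (∀ d → d < length w → f d ≡ g d) → f ∈ʷ w → g ∈ʷ w
∈ʷ-resp-≗ w f≗g f∈w d d<w = subst (λ b → Match b (at w d)) (f≗g d d<w) (f∈w d d<w)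

FirstTrue-resp-≗ : ∀ {f g} a → f ≗ g → FirstTrue f a → FirstTrue g a
FirstTrue-resp-≗ a f≗g (fa , zeros) = trans (sym (f≗g a)) fa , λ q q<a → trans (sym (f≗g q)) (zeros q q<a)

FirstTrue-unique : ∀ {f u v} → FirstTrue f u → FirstTrue f v → u ≡ v
FirstTrue-unique {u = u} {v} (fu , below-u) (fv , below-v) with <-cmp u v
... | tri< u<v _ _ = ⊥-elim (clash fu (below-v u u<v))
... | tri≈ _ u≡v _ = u≡v
... | tri> _ _ v<u = ⊥-elim (clash fv (below-u v v<u))

first-true? : ∀ g len → Zeros len g ⊎ Σ ℕ λ u → u < len × FirstTrue g u
first-true? g zero = inj₁ (λ _ ())
first-true? g (suc len) with g 0 in g0≡
... | true  = inj₂ (0 , s≤s z≤n , g0≡ , λ _ ())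
... | false with first-true? (shift 1 g) len
...   | inj₁ zeros = inj₁ λ { zero _ → g0≡ ; (suc q) (s≤s q<len) → zeros q q<len }
...   | inj₂ (u , u<len , gu , below) =
  inj₂ (suc u , s≤s u<len , gu , λ { zero _ → g0≡ ; (suc q) (s≤s q<u) → below q q<u })

∈ʷ-∷ : ∀ {f c} w → f ∈ʷ c ∷ w ⇔ (Match (f 0) c × shift 1 f ∈ʷ w)
∈ʷ-∷ w = mk⇔ (λ h → h 0 (s≤s z≤n) , λ d d<w → h (suc d) (s≤s d<w))
              (λ { (m , h) zero _ → m ; (m , h) (suc d) (s≤s d<w) → h d d<w })

∈ʷ-replicate-++ : ∀ {f c} a w →
  f ∈ʷ replicate a c ++ w ⇔ ((∀ q → q < a → Match (f q) c) × shift a f ∈ʷ w)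
∈ʷ-replicate-++ zero    w = mk⇔ ((λ _ ()) ,_) (λ (_ , h) → h)
∈ʷ-replicate-++ {f} {c} (suc a) w = mk⇔ to from
  where
  IH = ∈ʷ-replicate-++ {shift 1 f} {c} a w
  to : f ∈ʷ replicate (suc a) c ++ w → (∀ q → q < suc a → Match (f q) c) × shift (suc a) f ∈ʷ w
  to h with Equivalence.to (∈ʷ-∷ _) h
  ... | m , h′ with Equivalence.to IH h′
  ...   | ms , rest = (λ { zero _ → m ; (suc q) (s≤s q<a) → ms q q<a }) , rest
  from : (∀ q → q < suc a → Match (f q) c) × shift (suc a) f ∈ʷ w → f ∈ʷ replicate (suc a) c ++ w
  from (ms , rest) = Equivalence.from (∈ʷ-∷ _)
    (ms 0 (s≤s z≤n) , Equivalence.from IH ((λ q q<a → ms (suc q) (s≤s q<a)) , rest))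

∈ʷ-block : ∀ {f} a w → f ∈ʷ replicate a O ++ I ∷ w ⇔ (FirstTrue f a × shift (suc a) f ∈ʷ w)
∈ʷ-block {f} a w = mk⇔ to from
  where
  to : f ∈ʷ replicate a O ++ I ∷ w → FirstTrue f a × shift (suc a) f ∈ʷ w
  to h with Equivalence.to (∈ʷ-replicate-++ a _) h
  ... | zeros , h′ with Equivalence.to (∈ʷ-∷ w) h′
  ...   | one , rest =
    (subst (λ x → f x ≡ true) (+-identityʳ a) (match-I one) , λ q q<a → match-O (zeros q q<a)) ,
    ∈ʷ-resp-≗ w (λ d _ → cong f (+-suc a d)) rest
  from : FirstTrue f a × shift (suc a) f ∈ʷ w → f ∈ʷ replicate a O ++ I ∷ w
  from ((one , zeros) , rest) = Equivalence.from (∈ʷ-replicate-++ a _)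
    ((λ q q<a → false-O (zeros q q<a)) ,
     Equivalence.from (∈ʷ-∷ w)
       (true-I (subst (λ x → f x ≡ true) (sym (+-identityʳ a)) one) ,
        ∈ʷ-resp-≗ w (λ d _ → cong f (sym (+-suc a d))) rest))

∈ʷ-stars-++ : ∀ {f} a w → f ∈ʷ replicate a S ++ w ⇔ shift a f ∈ʷ w
∈ʷ-stars-++ a w = mk⇔ (λ h → Equivalence.to (∈ʷ-replicate-++ a w) h .proj₂)
                      (λ h → Equivalence.from (∈ʷ-replicate-++ a w) ((λ q _ → match-S _) , h))

∈ʷ-replicate : ∀ {f c} a → f ∈ʷ replicate a c ⇔ (∀ q → q < a → Match (f q) c)
∈ʷ-replicate {f} {c} a = mk⇔
  (λ h → Equivalence.to (∈ʷ-replicate-++ a []) (subst (f ∈ʷ_) (sym (++-identityʳ (replicate a c))) h) .proj₁)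
  (λ ms → subst (f ∈ʷ_) (++-identityʳ (replicate a c)) (Equivalence.from (∈ʷ-replicate-++ a []) (ms , λ _ ())))

toPoint : List Bool → Point
toPoint []       _       = false
toPoint (b ∷ _)  zero    = b
toPoint (_ ∷ bs) (suc d) = toPoint bs d

Mem⇔∈ʷ : ∀ bs w → length bs ≡ length w → Mem bs w ⇔ toPoint bs ∈ʷ w
Mem⇔∈ʷ bs w eq = mk⇔ (to bs w) (from bs w eq)
  where
  to : ∀ bs w → Mem bs w → toPoint bs ∈ʷ w
  to (b ∷ bs) (c ∷ w) (m , ms) zero    _         = m
  to (b ∷ bs) (c ∷ w) (m , ms) (suc d) (s≤s d<w) = to bs w ms d d<w
  from : ∀ bs w → length bs ≡ length w → toPoint bs ∈ʷ w → Mem bs w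
  from []       []      _  _ = tt
  from (b ∷ bs) (c ∷ w) eq h =
    h 0 (s≤s z≤n) , from bs w (suc-injective eq) (λ d d<w → h (suc d) (s≤s d<w))

∈ᶜ⇔∈ʷ : ∀ {n} (x : Vec Bool n) w → length w ≡ n → x ∈ᶜ w ⇔ toPoint (toList x) ∈ʷ w
∈ᶜ⇔∈ʷ x w eq = Mem⇔∈ʷ (toList x) w (trans (length-toList x) (sym eq))

fromPoint : ∀ n → Point → Vec Bool n
fromPoint n f = tabulate (λ i → f (toℕ i))

toPoint-fromPoint : ∀ n f d → d < n → toPoint (toList (fromPoint n f)) d ≡ f d
toPoint-fromPoint (suc n) f zero    _         = refl
toPoint-fromPoint (suc n) f (suc d) (s≤s d<n) = toPoint-fromPoint n (shift 1 f) d d<n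

fromPoint-∈ᶜ : ∀ {n} f w → length w ≡ n → fromPoint n f ∈ᶜ w ⇔ f ∈ʷ w
fromPoint-∈ᶜ {n} f w eq = mk⇔
  (λ h → ∈ʷ-resp-≗ w agree (Equivalence.to (∈ᶜ⇔∈ʷ _ w eq) h))
  (λ h → Equivalence.from (∈ᶜ⇔∈ʷ _ w eq) (∈ʷ-resp-≗ w (λ d d<w → sym (agree d d<w)) h))
  where
  agree : ∀ d → d < length w → toPoint (toList (fromPoint n f)) d ≡ f d
  agree d d<w = toPoint-fromPoint n f d (subst (d <_) eq d<w)

isI : Sym → Bool
isI I = true
isI O = false
isI S = false

corner : Word → Point
corner w d = isI (at w d)

corner-∈ʷ : ∀ w → corner w ∈ʷ w
corner-∈ʷ w d _ = match-isI (at w d)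
  where
  match-isI : ∀ c → Match (isI c) c
  match-isI O = tt
  match-isI I = tt
  match-isI S = tt

corner-true : ∀ w d → corner w d ≡ true → at w d ≡ I
corner-true w d eq with at w d
... | I = refl

_[_]≔_ : Point → ℕ → Bool → Point
(f [ d ]≔ b) p with p ≟ d
... | yes _ = b
... | no  _ = f p

[]≔-same : ∀ f d b → (f [ d ]≔ b) d ≡ b
[]≔-same f d b with d ≟ d
... | yes _   = refl
... | no  d≢d = ⊥-elim (d≢d refl)

[]≔-other : ∀ f d b p → p ≢ d → (f [ d ]≔ b) p ≡ f p
[]≔-other f d b p p≢d with p ≟ d
... | yes p≡d = ⊥-elim (p≢d p≡d)
... | no  _   = refl

[]≔-revert : ∀ f c b d → ((f [ c ]≔ b) [ c ]≔ f c) d ≡ f d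
[]≔-revert f c b d = by-cases (d ≟ c)
  where
  by-cases : Dec (d ≡ c) → ((f [ c ]≔ b) [ c ]≔ f c) d ≡ f d
  by-cases (yes refl) = []≔-same _ d (f d)
  by-cases (no d≢c)   = trans ([]≔-other _ c (f c) d d≢c) ([]≔-other f c b d d≢c)

single : ℕ → Point
single t = (λ _ → false) [ t ]≔ true

single-true : ∀ t p → single t p ≡ true → p ≡ t
single-true t p eq with p ≟ t
... | yes p≡t = p≡t

at-≢S⇒< : ∀ w d → at w d ≢ S → d < length w
at-≢S⇒< []      d       ≢S = ⊥-elim (≢S refl)
at-≢S⇒< (c ∷ w) zero    _  = s≤s z≤n
at-≢S⇒< (c ∷ w) (suc d) ≢S = s≤s (at-≢S⇒< w d ≢S)

∈ʷ-at-I : ∀ {f} w d → f ∈ʷ w → at w d ≡ I → f d ≡ true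
∈ʷ-at-I {f} w d f∈w eq =
  match-I (subst (Match (f d)) eq (f∈w d (at-≢S⇒< w d (I⇒≢S eq))))

∈ʷ-at-O : ∀ {f} w d → f ∈ʷ w → at w d ≡ O → f d ≡ false
∈ʷ-at-O {f} w d f∈w eq =
  match-O (subst (Match (f d)) eq (f∈w d (at-≢S⇒< w d (O⇒≢S eq))))

∈ʷ-[]≔ : ∀ {f b} w d → Match b (at w d) → f ∈ʷ w → (f [ d ]≔ b) ∈ʷ w
∈ʷ-[]≔ w d m f∈w p p<w with p ≟ d
... | yes refl = m
... | no  _    = f∈w p p<w

differ⇒S : ∀ {f g} w d → f ∈ʷ w → g ∈ʷ w → d < length w → f d ≡ true → g d ≡ false → at w d ≡ S
differ⇒S {f} {g} w d f∈w g∈w d<w fd gd with at w d | f∈w d d<w | g∈w d d<w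
... | S | _  | _  = refl
... | O | mf | _  = ⊥-elim (clash fd (match-O mf))
... | I | _  | mg = ⊥-elim (clash (match-I mg) gd)

⊆⇒Match : ∀ {b} a s → (∀ f → f ∈ʷ a → f ∈ʷ s) → ∀ d → d < length s → Match b (at a d) → Match b (at s d)
⊆⇒Match {b} a s a⊆s d d<s m = subst (λ x → Match x (at s d)) ([]≔-same (corner a) d b)
  (a⊆s _ (∈ʷ-[]≔ a d m (corner-∈ʷ a)) d d<s)

Match-⊆⇒≡ : ∀ {x y} → (∀ {b} → Match b y → Match b x) → x ≢ S → y ≡ x
Match-⊆⇒≡ {O} {O} _ _   = refl
Match-⊆⇒≡ {I} {I} _ _   = refl
Match-⊆⇒≡ {S} _   x≢S   = ⊥-elim (x≢S refl)
Match-⊆⇒≡ {O} {I} y⊆x _ = ⊥-elim (y⊆x {true} tt)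
Match-⊆⇒≡ {O} {S} y⊆x _ = ⊥-elim (y⊆x {true} tt)
Match-⊆⇒≡ {I} {O} y⊆x _ = ⊥-elim (y⊆x {false} tt)
Match-⊆⇒≡ {I} {S} y⊆x _ = ⊥-elim (y⊆x {false} tt)

⊆⇒agree : ∀ a s → (∀ f → f ∈ʷ a → f ∈ʷ s) → ∀ d → at s d ≢ S → at a d ≡ at s d
⊆⇒agree a s a⊆s d s≢S = Match-⊆⇒≡ (⊆⇒Match a s a⊆s d (at-≢S⇒< s d s≢S)) s≢S

-- Counting ones

one : Sym → ℕ
one I = 1
one O = 0
one S = 0

ones : Word → ℕ
ones []      = 0
ones (c ∷ w) = one c + ones w

one-≢I : ∀ {c} → c ≢ I → one c ≡ 0
one-≢I {O} _   = refl
one-≢I {S} _   = refl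
one-≢I {I} c≢I = ⊥-elim (c≢I refl)

one-cong : ∀ {x y} → x ≡ I ⇔ y ≡ I → one x ≡ one y
one-cong {I} x⇔y rewrite Equivalence.to x⇔y refl = refl
one-cong {O} {I} x⇔y with () ← Equivalence.from x⇔y refl
one-cong {S} {I} x⇔y with () ← Equivalence.from x⇔y refl
one-cong {O} {O} _ = refl
one-cong {O} {S} _ = refl
one-cong {S} {O} _ = refl
one-cong {S} {S} _ = refl

ones-++ : ∀ u w → ones (u ++ w) ≡ ones u + ones w
ones-++ []      w = refl
ones-++ (c ∷ u) w = trans (cong (one c +_) (ones-++ u w)) (sym (+-assoc (one c) _ _))

ones-replicate : ∀ c → c ≢ I → ∀ a → ones (replicate a c) ≡ 0
ones-replicate c c≢I zero    = refl
ones-replicate c c≢I (suc a) = cong₂ _+_ (one-≢I c≢I) (ones-replicate c c≢I a)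

ones-replicate-++ : ∀ c → c ≢ I → ∀ a w → ones (replicate a c ++ w) ≡ ones w
ones-replicate-++ c c≢I a w = trans (ones-++ (replicate a c) w) (cong (_+ ones w) (ones-replicate c c≢I a))

ones-rotate : ∀ r w → ones (rotate r w) ≡ ones w
ones-rotate r w = begin
  ones (drop r w ++ take r w)        ≡⟨ ones-++ (drop r w) (take r w) ⟩
  ones (drop r w) + ones (take r w)  ≡⟨ +-comm (ones (drop r w)) _ ⟩
  ones (take r w) + ones (drop r w)  ≡⟨ sym (ones-++ (take r w) (drop r w)) ⟩
  ones (take r w ++ drop r w)        ≡⟨ cong ones (take++drop≡id r w) ⟩
  ones w                             ∎
  where open ≡-Reasoning

ones-cong : ∀ a b → length a ≡ length b → (∀ d → at a d ≡ I ⇔ at b d ≡ I) → ones a ≡ ones b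
ones-cong []      []      _  _   = refl
ones-cong (x ∷ a) (y ∷ b) eq a⇔b =
  cong₂ _+_ (one-cong (a⇔b 0)) (ones-cong a b (suc-injective eq) (λ d → a⇔b (suc d)))

ones-insert : ∀ a b c → length a ≡ length b → at a c ≢ I → at b c ≡ I →
              (∀ d → d ≢ c → at a d ≡ I ⇔ at b d ≡ I) → ones b ≡ suc (ones a)
ones-insert (x ∷ a) (y ∷ b) zero eq x≢I refl a⇔b =
  cong suc (trans (sym (ones-cong a b (suc-injective eq) (λ d → a⇔b (suc d) λ ())))
                  (sym (cong (_+ ones a) (one-≢I x≢I))))
ones-insert (x ∷ a) (y ∷ b) (suc c) eq a≢I bI a⇔b = begin
  one y + ones b         ≡⟨ cong₂ _+_ (sym (one-cong (a⇔b 0 λ ()))) tails ⟩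
  one x + suc (ones a)   ≡⟨ +-suc (one x) (ones a) ⟩
  suc (one x + ones a)   ∎
  where
  open ≡-Reasoning
  tails : ones b ≡ suc (ones a)
  tails = ones-insert a b c (suc-injective eq) a≢I bI (λ d d≢c → a⇔b (suc d) (λ e → d≢c (suc-injective e)))

-- Rotations of 0^m 1 *^m

dim : ℕ → ℕ
dim m = suc (2 * m)

-- p is one of the m positions preceding t cyclically modulo dim m (for p, t < dim m).
Preceding : ℕ → ℕ → ℕ → Set
Preceding m t p = (p < t × t ≤ p + m) ⊎ t + m < p

RotationPoint : ℕ → ℕ → Point → Set
RotationPoint m t f = f t ≡ true × (∀ p → p < dim m → Preceding m t p → f p ≡ false)

-- Rotating baseWord m by r moves its 1 from position m to position t.
RotatedOne : ℕ → ℕ → ℕ → Set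
RotatedOne m r t = t + r ≡ m ⊎ t + r ≡ m + dim m

m+1+m≡dim : ∀ m → m + suc m ≡ dim m
m+1+m≡dim = identity
  where
  identity : ∀ m → m + suc m ≡ suc (2 * m)
  identity = solve-∀

double : ∀ m → 2 * m ≡ m + m
double = solve-∀

Preceding⇒≢ : ∀ {m t p} → Preceding m t p → p ≢ t
Preceding⇒≢ (inj₁ (p<t , _))       = <⇒≢ p<t
Preceding⇒≢ {m} {t} (inj₂ t+m<p) = >⇒≢ (≤-<-trans (m≤m+n t m) t+m<p)

rotate-baseWord-≤ : ∀ r t → rotate r (baseWord (r + t)) ≡ replicate t O ++ I ∷ replicate (r + t) S ++ replicate r O
rotate-baseWord-≤ r t = begin
  rotate r (baseWord (r + t))                          ≡⟨ cong (rotate r) split ⟩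
  rotate r (replicate r O ++ Y)                        ≡⟨ cong (λ k → rotate k (replicate r O ++ Y)) (sym (length-replicate r)) ⟩
  rotate (length (replicate r O)) (replicate r O ++ Y) ≡⟨ rotate-++ (replicate r O) Y ⟩
  Y ++ replicate r O                                   ≡⟨ ++-assoc (replicate t O) _ _ ⟩
  replicate t O ++ I ∷ replicate (r + t) S ++ replicate r O ∎
  where
  open ≡-Reasoning
  Y = replicate t O ++ I ∷ replicate (r + t) S
  split : baseWord (r + t) ≡ replicate r O ++ Y
  split = trans (cong (_++ I ∷ replicate (r + t) S) (replicate-+ r t O)) (++-assoc (replicate r O) _ _)

rotate-baseWord-> : ∀ u v → let m = suc (u + v) in
  rotate (suc (m + u)) (baseWord m) ≡ replicate (suc v) S ++ replicate m O ++ I ∷ replicate u S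
rotate-baseWord-> u v = begin
  rotate (suc (m + u)) (baseWord m)                    ≡⟨ cong (rotate (suc (m + u))) split ⟩
  rotate (suc (m + u)) (X ++ replicate (suc v) S)     ≡⟨ cong (λ k → rotate k (X ++ replicate (suc v) S)) (sym length-X) ⟩
  rotate (length X) (X ++ replicate (suc v) S)        ≡⟨ rotate-++ X (replicate (suc v) S) ⟩
  replicate (suc v) S ++ X                            ∎
  where
  open ≡-Reasoning
  m = suc (u + v)
  X = replicate m O ++ I ∷ replicate u S
  split : baseWord m ≡ X ++ replicate (suc v) S
  split = trans (cong (λ w → replicate m O ++ I ∷ w)
                      (trans (cong (λ k → replicate k S) (sym (+-suc u v))) (replicate-+ u (suc v) S)))
                (sym (++-assoc (replicate m O) (I ∷ replicate u S) _))
  length-X : length X ≡ suc (m + u)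
  length-X = trans (length-++ (replicate m O))
                   (trans (cong₂ (λ a b → a + suc b) (length-replicate m) (length-replicate u)) (+-suc m u))

rotation≤-char : ∀ r t → Characterises (RotationPoint (r + t) t) (replicate t O ++ I ∷ replicate (r + t) S ++ replicate r O)
rotation≤-char r t f = mk⇔ to from
  where
  m = r + t
  rest : Word
  rest = replicate m S ++ replicate r O
  trailing : ℕ → ℕ
  trailing q = suc t + (m + q)
  t<n : t < dim m
  t<n = s≤s (≤-trans (m≤n+m t r) (m≤m+n m _))
  trailing<n : ∀ {q} → q < r → trailing q < dim m
  trailing<n {q} q<r = s≤s (begin
    suc (t + (m + q)) ≡⟨ shuffle t m q ⟩
    t + m + suc q     ≤⟨ +-monoʳ-≤ (t + m) q<r ⟩
    t + m + r         ≡⟨ regroup r t ⟩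
    2 * m             ∎)
    where
    open ≤-Reasoning
    shuffle : ∀ t m q → suc (t + (m + q)) ≡ t + m + suc q
    shuffle = solve-∀
    regroup : ∀ r t → t + (r + t) + r ≡ 2 * (r + t)
    regroup = solve-∀
  to : f ∈ʷ replicate t O ++ I ∷ rest → RotationPoint m t f
  to h with Equivalence.to (∈ʷ-block t rest) h
  ... | (ft , leading) , h′ = ft , zeroAt
    where
    trailing-zero : ∀ q → q < r → f (trailing q) ≡ false
    trailing-zero q q<r = match-O (Equivalence.to (∈ʷ-replicate r) (Equivalence.to (∈ʷ-stars-++ m (replicate r O)) h′) q q<r)
    zeroAt : ∀ p → p < dim m → Preceding m t p → f p ≡ false
    zeroAt p _   (inj₁ (p<t , _)) = leading p p<t
    zeroAt p p<n (inj₂ t+m<p) with m≤n⇒∃[o]m+o≡n t+m<p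
    ... | q , refl = subst (λ x → f x ≡ false) (cong suc (sym (+-assoc t m q))) (trailing-zero q q<r)
      where
      regroup : ∀ r t → 2 * (r + t) ≡ t + (r + t) + r
      regroup = solve-∀
      q<r : q < r
      q<r = +-cancelˡ-< (t + m) q r (subst (t + m + q <_) (regroup r t) (s≤s⁻¹ p<n))
  from : RotationPoint m t f → f ∈ʷ replicate t O ++ I ∷ rest
  from (ft , zeroAt) = Equivalence.from (∈ʷ-block t rest)
    ((ft , λ q q<t → zeroAt q (<-trans q<t t<n) (inj₁ (q<t , ≤-trans (m≤n+m t r) (m≤n+m m q)))) ,
     Equivalence.from (∈ʷ-stars-++ m (replicate r O)) (Equivalence.from (∈ʷ-replicate r)
       (λ q q<r → false-O (zeroAt (trailing q) (trailing<n q<r) (inj₂ (s≤s (+-monoʳ-≤ t (m≤m+n m q))))))))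

rotation>-char : ∀ u v → let m = suc (u + v) in
  Characterises (RotationPoint m (suc v + m)) (replicate (suc v) S ++ replicate m O ++ I ∷ replicate u S)
rotation>-char u v f = mk⇔ to from
  where
  m = suc (u + v)
  t = suc v + m
  rest : Word
  rest = replicate m O ++ I ∷ replicate u S
  t≤n : t ≤ dim m
  t≤n = ≤-of-+ t (suc u) (identity u v)
    where
    identity : ∀ u v → suc v + suc (u + v) + suc u ≡ suc (2 * suc (u + v))
    identity = solve-∀
  to : f ∈ʷ replicate (suc v) S ++ rest → RotationPoint m t f
  to h with Equivalence.to (∈ʷ-block m (replicate u S)) (Equivalence.to (∈ʷ-stars-++ (suc v) rest) h)
  ... | (ft , zeros) , _ = ft , zeroAt
    where
    zeroAt : ∀ p → p < dim m → Preceding m t p → f p ≡ false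
    zeroAt p _ (inj₁ (p<t , t≤p+m)) with m≤n⇒∃[o]m+o≡n (+-cancelʳ-≤ m (suc v) p t≤p+m)
    ... | q , refl = zeros q (+-cancelˡ-< (suc v) q m p<t)
    zeroAt p p<n (inj₂ t+m<p) = ⊥-elim (<⇒≱ t+m<p (≤-trans (s≤s⁻¹ p<n) (≤-of-+ (2 * m) (suc v) (identity v m))))
      where
      identity : ∀ v m → 2 * m + suc v ≡ suc v + m + m
      identity = solve-∀
  from : RotationPoint m t f → f ∈ʷ replicate (suc v) S ++ rest
  from (ft , zeroAt) = Equivalence.from (∈ʷ-stars-++ (suc v) rest) (Equivalence.from (∈ʷ-block m (replicate u S))
    ((ft , λ q q<m → zeroAt (suc v + q) (<-≤-trans (+-monoʳ-< (suc v) q<m) t≤n)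
                       (inj₁ (+-monoʳ-< (suc v) q<m , +-monoˡ-≤ m (m≤m+n (suc v) q)))) ,
     Equivalence.from (∈ʷ-replicate u) (λ q _ → match-S _)))

m+u<dim⇒u<m : ∀ m u → suc (m + u) < dim m → u < m
m+u<dim⇒u<m m u lt = subst (u <_) (+-identityʳ m) (+-cancelˡ-< m u (m + 0) (s≤s⁻¹ lt))

rotation-char : ∀ m r → r < dim m →
  Σ ℕ λ t → t < dim m × RotatedOne m r t × Characterises (RotationPoint m t) (rotate r (baseWord m))
rotation-char m r r<n with r ≤? m
... | yes r≤m with m≤n⇒∃[o]m+o≡n r≤m
...   | t , refl = t , s≤s (≤-trans (m≤n+m t r) (m≤m+n (r + t) _)) , inj₁ (+-comm t r) ,
                   subst (Characterises _) (sym (rotate-baseWord-≤ r t)) (rotation≤-char r t)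
rotation-char m r r<n | no r≰m with m≤n⇒∃[o]m+o≡n (≰⇒> r≰m)
... | u , refl with m≤n⇒∃[o]m+o≡n (m+u<dim⇒u<m m u r<n)
...   | v , refl = suc v + suc (u + v) , <-of-+ _ u (bound u v) , inj₂ (lands u v) ,
                   subst (Characterises _) (sym (rotate-baseWord-> u v)) (rotation>-char u v)
  where
  bound : ∀ u v → suc (suc v + suc (u + v) + u) ≡ suc (2 * suc (u + v))
  bound = solve-∀
  lands : ∀ u v → suc v + suc (u + v) + suc (suc (u + v) + u) ≡ suc (u + v) + suc (2 * suc (u + v))
  lands = solve-∀

RotatedOne-exists : ∀ m t → t < dim m → Σ ℕ λ r → r < dim m × RotatedOne m r t
RotatedOne-exists m t t<n with t ≤? m
... | yes t≤m = m ∸ t , ≤-<-trans (m∸n≤m m t) (s≤s (m≤m+n m _)) , inj₁ (m+[n∸m]≡n t≤m)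
... | no  t≰m = m + dim m ∸ t , r<n , inj₂ lands
  where
  lands : t + (m + dim m ∸ t) ≡ m + dim m
  lands = m+[n∸m]≡n (≤-trans (<⇒≤ t<n) (m≤n+m (dim m) m))
  r<n : m + dim m ∸ t < dim m
  r<n = +-cancelˡ-< t _ (dim m) (subst (_< t + dim m) (sym lands) (+-monoˡ-< (dim m) (≰⇒> t≰m)))

rotation-at : ∀ m t → t < dim m → Σ ℕ λ r → r < dim m × Characterises (RotationPoint m t) (rotate r (baseWord m))
rotation-at m t t<n with RotatedOne-exists m t t<n
... | r , r<n , one with rotation-char m r r<n
...   | t′ , t′<n , one′ , char =
  r , r<n , subst (λ x → Characterises (RotationPoint m x) (rotate r (baseWord m))) (+-cancelʳ-mod t′<n t<n one′ one) char

RotatedOne-injective : ∀ {m r r′ t} → r < dim m → r′ < dim m → RotatedOne m r t → RotatedOne m r′ t → r ≡ r′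
RotatedOne-injective {m} {r} {r′} {t} r<n r′<n one one′ = +-cancelʳ-mod r<n r′<n (commute one) (commute one′)
  where
  commute : ∀ {x} → RotatedOne m x t → x + t ≡ m ⊎ x + t ≡ m + dim m
  commute {x} (inj₁ e) = inj₁ (trans (+-comm x t) e)
  commute {x} (inj₂ e) = inj₂ (trans (+-comm x t) e)

single-RotationPoint : ∀ m t → RotationPoint m t (single t)
single-RotationPoint m t = []≔-same _ t true , λ p _ pre → []≔-other _ t true p (Preceding⇒≢ pre)

rotation-one : ∀ {m t w} → Characterises (RotationPoint m t) w → ∀ d → at w d ≡ I → d ≡ t
rotation-one {m} {t} {w} char d eq =
  single-true t d (∈ʷ-at-I w d (Equivalence.from (char (single t)) (single-RotationPoint m t)) eq)

rotation-star : ∀ {m t w} → Characterises (RotationPoint m t) w →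
                ∀ p → p < length w → p ≢ t → ¬ Preceding m t p → at w p ≡ S
rotation-star {m} {t} {w} char p p<w p≢t ¬pre =
  differ⇒S w p (Equivalence.from (char raised) raised-point) (Equivalence.from (char (single t)) (single-RotationPoint m t))
           p<w ([]≔-same (single t) p true) ([]≔-other _ t true p p≢t)
  where
  raised : Point
  raised = single t [ p ]≔ true
  raised-point : RotationPoint m t raised
  raised-point =
    trans ([]≔-other (single t) p true t (λ t≡p → p≢t (sym t≡p))) ([]≔-same _ t true) ,
    λ q q<n pre → trans ([]≔-other (single t) p true q (λ q≡p → ¬pre (subst (Preceding m t) q≡p pre)))
                        (proj₂ (single-RotationPoint m t) q q<n pre)

Preceding-total : ∀ m t t′ → t ≢ t′ → Preceding m t t′ ⊎ Preceding m t′ t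
Preceding-total m t t′ t≢t′ with <-cmp t t′
... | tri≈ _ t≡t′ _ = ⊥-elim (t≢t′ t≡t′)
... | tri< t<t′ _ _ with t′ ≤? t + m
...   | yes t′≤t+m = inj₂ (inj₁ (t<t′ , t′≤t+m))
...   | no  t′≰t+m = inj₁ (inj₂ (≰⇒> t′≰t+m))
Preceding-total m t t′ t≢t′ | tri> _ _ t′<t with t ≤? t′ + m
...   | yes t≤t′+m = inj₁ (inj₁ (t′<t , t≤t′+m))
...   | no  t≰t′+m = inj₂ (inj₂ (≰⇒> t≰t′+m))

¬Preceding-suc : ∀ {m} t → 1 ≤ m → ¬ Preceding m t (suc t)
¬Preceding-suc t _   (inj₁ (t+1<t , _)) = <-asym t+1<t (n<1+n t)
¬Preceding-suc {m} t 1≤m (inj₂ t+m<t+1) = <⇒≱ t+m<t+1 (subst (_≤ t + m) (+-comm t 1) (+-monoʳ-≤ t 1≤m))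

¬Preceding-0 : ∀ {m} → 1 ≤ m → ¬ Preceding m (2 * m) 0
¬Preceding-0 {m} 1≤m (inj₁ (_ , 2m≤m)) = <⇒≱ (m<m+n m (≤-trans 1≤m (m≤m+n m 0))) 2m≤m
¬Preceding-0 {m} 1≤m (inj₂ ())

length-baseWord : ∀ m → length (baseWord m) ≡ dim m
length-baseWord m = trans (length-++ (replicate m O))
  (trans (cong₂ (λ a b → a + suc b) (length-replicate m) (length-replicate m)) (m+1+m≡dim m))

-- Triple words

-- The triples (i, j, k) enumerated by triples m; equivalently i + j < m and j + k < m.
ValidTriple : ℕ → ℕ → ℕ → ℕ → Set
ValidTriple m i j k = i < m × j < m ∸ i × k < m ∸ j

TriplePoint : ℕ → ℕ → ℕ → ℕ → Point → Set
TriplePoint m i j k f = FirstTrue f i × FirstTrue (shift (i + suc j) f) k × FirstTrue (shift (i + suc m) f) j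

ValidTriple⇒sums : ∀ {m i j k} → ValidTriple m i j k → i + j < m × j + k < m
ValidTriple⇒sums {i = i} (i<m , j<m∸i , k<m∸j) = <∸⇒+< i<m j<m∸i , <∸⇒+< (<-≤-trans j<m∸i (m∸n≤m _ i)) k<m∸j

-- The run of stars m ∸ 1 ∸ a ∸ b closes a block of length m.
gap : ∀ a b {m} → a + b < m → a + b + suc (m ∸ 1 ∸ a ∸ b) ≡ m
gap a b a+b<m with m≤n⇒∃[o]m+o≡n a+b<m
... | d , refl = begin
  a + b + suc (a + b + d ∸ a ∸ b)   ≡⟨ cong (λ x → a + b + suc (x ∸ b)) (trans (cong (_∸ a) (+-assoc a b d))
                                                                        (m+n∸m≡n a (b + d))) ⟩
  a + b + suc (b + d ∸ b)           ≡⟨ cong (λ x → a + b + suc x) (m+n∸m≡n b d) ⟩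
  a + b + suc d                     ≡⟨ +-suc (a + b) d ⟩
  suc (a + b + d)                   ∎
  where open ≡-Reasoning

tripleWord-length : ∀ {m i j k} → ValidTriple m i j k → length (tripleWord m i j k) ≡ dim m
tripleWord-length {m} {i} {j} {k} valid = begin
  length (tripleWord m i j k)                           ≡⟨ blocks ⟩
  i + suc (j + (k + suc (g + (j + suc h))))             ≡⟨ regroup i j k g h ⟩
  (j + k + suc g) + suc (i + j + suc h)                 ≡⟨ cong₂ (λ x y → x + suc y) (gap j k jk<m) (gap i j ij<m) ⟩
  m + suc m                                             ≡⟨ m+1+m≡dim m ⟩
  dim m                                                 ∎
  where
  open ≡-Reasoning
  g = m ∸ 1 ∸ j ∸ k
  h = m ∸ 1 ∸ i ∸ j
  ij<m = proj₁ (ValidTriple⇒sums valid)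
  jk<m = proj₂ (ValidTriple⇒sums valid)
  regroup : ∀ i j k g h → i + suc (j + (k + suc (g + (j + suc h)))) ≡ (j + k + suc g) + suc (i + j + suc h)
  regroup = solve-∀
  blocks : length (tripleWord m i j k) ≡ i + suc (j + (k + suc (g + (j + suc h))))
  blocks =
    trans (length-replicate-++ i _) (cong (λ x → i + suc x)
    (trans (length-replicate-++ j _) (cong (j +_)
    (trans (length-replicate-++ k _) (cong (λ x → k + suc x)
    (trans (length-replicate-++ g _) (cong (g +_)
    (trans (length-replicate-++ j _) (cong (λ x → j + suc x) (length-replicate h))))))))))

tripleWord-char : ∀ {m i j k} → ValidTriple m i j k → Characterises (TriplePoint m i j k) (tripleWord m i j k)
tripleWord-char {m} {i} {j} {k} valid f = mk⇔ to from
  where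
  g = m ∸ 1 ∸ j ∸ k
  h = m ∸ 1 ∸ i ∸ j
  w₃ = replicate j O ++ I ∷ replicate h S
  w₂ = replicate k O ++ I ∷ replicate g S ++ w₃
  f₂ : Point
  f₂ q = f (suc i + (j + q))
  f₃ : Point
  f₃ q = f₂ (suc k + (g + q))
  second : f₂ ≗ shift (i + suc j) f
  second q = cong f (regroup i j q)
    where
    regroup : ∀ i j q → suc i + (j + q) ≡ i + suc j + q
    regroup = solve-∀
  third : f₃ ≗ shift (i + suc m) f
  third q = cong f (trans (regroup i j k g q) (cong (λ x → i + suc x + q) (gap j k (proj₂ (ValidTriple⇒sums valid)))))
    where
    regroup : ∀ i j k g q → suc i + (j + (suc k + (g + q))) ≡ i + suc (j + k + suc g) + q
    regroup = solve-∀
  to : f ∈ʷ tripleWord m i j k → TriplePoint m i j k f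
  to h₀ =
    let first  , h₁ = Equivalence.to (∈ʷ-block {f} i (replicate j S ++ w₂)) h₀
        second′ , h₂ = Equivalence.to (∈ʷ-block {f₂} k (replicate g S ++ w₃)) (Equivalence.to (∈ʷ-stars-++ j w₂) h₁)
        third′ , _  = Equivalence.to (∈ʷ-block {f₃} j (replicate h S)) (Equivalence.to (∈ʷ-stars-++ g w₃) h₂)
    in first , FirstTrue-resp-≗ k second second′ , FirstTrue-resp-≗ j third third′
  from : TriplePoint m i j k f → f ∈ʷ tripleWord m i j k
  from (first , second′ , third′) =
    Equivalence.from (∈ʷ-block {f} i (replicate j S ++ w₂)) (first ,
    Equivalence.from (∈ʷ-stars-++ j w₂) (Equivalence.from (∈ʷ-block {f₂} k (replicate g S ++ w₃))
      (FirstTrue-resp-≗ k (λ q → sym (second q)) second′ ,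
       Equivalence.from (∈ʷ-stars-++ g w₃) (Equivalence.from (∈ʷ-block {f₃} j (replicate h S))
         (FirstTrue-resp-≗ j (λ q → sym (third q)) third′ , Equivalence.from (∈ʷ-replicate h) (λ q _ → match-S _))))))

second≤i+m : ∀ {m i j k} → ValidTriple m i j k → i + suc j + k ≤ i + m
second≤i+m {m} {i} {j} {k} valid = subst (_≤ i + m) (sym (+-assoc i (suc j) k)) (+-monoʳ-≤ i (proj₂ (ValidTriple⇒sums valid)))

third<dim : ∀ {m} i j → i + j < m → i + suc m + j < dim m
third<dim {m} i j i+j<m = subst (_< dim m) (sym (regroup m i j)) (s≤s (subst (m + (i + j) <_) (sym (double m)) (+-monoʳ-< m i+j<m)))
  where
  regroup : ∀ m i j → i + suc m + j ≡ suc (m + (i + j))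
  regroup = solve-∀

triple-ones<dim : ∀ {m i j k} → ValidTriple m i j k → i < dim m × i + suc j + k < dim m × i + suc m + j < dim m
triple-ones<dim {m} {i} {j} {k} valid =
  ≤-<-trans (m≤m+n i m) i+m<n ,
  ≤-<-trans (second≤i+m valid) i+m<n ,
  third<dim i j (proj₁ (ValidTriple⇒sums valid))
  where
  i+m<n : i + m < dim m
  i+m<n = s≤s (subst (i + m ≤_) (sym (double m)) (+-monoˡ-≤ m (<⇒≤ (proj₁ valid))))

Preceding-triple : ∀ {m i j k} t → t < dim m → ValidTriple m i j k →
  Preceding m t i ⊎ Preceding m t (i + suc j + k) ⊎ Preceding m t (i + suc m + j)
Preceding-triple {m} {i} {j} {k} t t<n valid with t ≤? i
... | yes t≤i = inj₂ (inj₂ (inj₂ (subst (t + m <_) (sym (regroup i m j))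
                                      (s≤s (≤-trans (+-monoˡ-≤ m t≤i) (m≤m+n (i + m) j))))))
  where
  regroup : ∀ i m j → i + suc m + j ≡ suc (i + m + j)
  regroup = solve-∀
... | no t≰i with t ≤? i + m
...   | yes t≤i+m = inj₁ (inj₁ (≰⇒> t≰i , t≤i+m))
...   | no  t≰i+m with t ≤? i + suc j + k + m
...     | yes t≤P₂+m = inj₂ (inj₁ (inj₁ (≤-<-trans (second≤i+m valid) (≰⇒> t≰i+m) , t≤P₂+m)))
...     | no  t≰P₂+m = inj₂ (inj₂ (inj₁ (≤-<-trans P₃≤P₂+m (≰⇒> t≰P₂+m) , ≤-trans (<⇒≤ t<n) n≤P₃+m)))
  where
  P₃≤P₂+m : i + suc m + j ≤ i + suc j + k + m
  P₃≤P₂+m = ≤-of-+ _ k (regroup i j k m)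
    where
    regroup : ∀ i j k m → i + suc m + j + k ≡ i + suc j + k + m
    regroup = solve-∀
  n≤P₃+m : dim m ≤ i + suc m + j + m
  n≤P₃+m = ≤-of-+ (dim m) (i + j) (regroup i j m)
    where
    regroup : ∀ i j m → suc (2 * m) + (i + j) ≡ i + suc m + j + m
    regroup = solve-∀

data Code : Set where
  origin   : Code
  rotation : ℕ → Code
  triple   : ℕ → ℕ → ℕ → Code

word : ℕ → Code → Word
word m origin         = replicate (dim m) O
word m (rotation r)   = rotate r (baseWord m)
word m (triple i j k) = tripleWord m i j k

Valid : ℕ → Code → Set
Valid m origin         = ⊤
Valid m (rotation r)   = r < dim m
Valid m (triple i j k) = ValidTriple m i j k

weight : Code → ℕ
weight origin         = 0
weight (rotation _)   = 1
weight (triple _ _ _) = 3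

word-length : ∀ m μ → Valid m μ → length (word m μ) ≡ dim m
word-length m origin         _     = length-replicate (dim m)
word-length m (rotation r)   _     = trans (length-rotate r (baseWord m)) (length-baseWord m)
word-length m (triple i j k) valid = tripleWord-length valid

ones-word : ∀ m μ → ones (word m μ) ≡ weight μ
ones-word m origin         = ones-replicate O (λ ()) (dim m)
ones-word m (rotation r)   = trans (ones-rotate r (baseWord m))
                                   (trans (ones-replicate-++ O (λ ()) m _) (cong suc (ones-replicate S (λ ()) m)))
ones-word m (triple i j k) =
  trans (ones-replicate-++ O (λ ()) i _) (cong suc
  (trans (ones-replicate-++ S (λ ()) j _) (trans (ones-replicate-++ O (λ ()) k _) (cong suc
  (trans (ones-replicate-++ S (λ ()) (m ∸ 1 ∸ j ∸ k) _) (trans (ones-replicate-++ O (λ ()) j _) (cong suc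
  (ones-replicate S (λ ()) (m ∸ 1 ∸ i ∸ j)))))))))

origin-point : ∀ m {f} → f ∈ʷ word m origin → Zeros (dim m) f
origin-point m f∈ q q<n = match-O (Equivalence.to (∈ʷ-replicate (dim m)) f∈ q q<n)

rotation-point : ∀ {m r f} → r < dim m → f ∈ʷ word m (rotation r) →
                 Σ ℕ λ t → t < dim m × RotatedOne m r t × RotationPoint m t f
rotation-point {m} {r} {f} r<n f∈ with rotation-char m r r<n
... | t , t<n , one , char = t , t<n , one , Equivalence.to (char f) f∈

origin∩rotation : ∀ m {r f} → r < dim m → f ∈ʷ word m origin → f ∈ʷ word m (rotation r) → ⊥
origin∩rotation m r<n f∈o f∈r with rotation-point r<n f∈r
... | t , t<n , _ , ft , _ = clash ft (origin-point m f∈o t t<n)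

origin∩triple : ∀ m {i j k f} → ValidTriple m i j k → f ∈ʷ word m origin → f ∈ʷ word m (triple i j k) → ⊥
origin∩triple m {f = f} valid f∈o f∈t =
  clash (proj₁ (proj₁ (Equivalence.to (tripleWord-char valid f) f∈t))) (origin-point m f∈o _ (proj₁ (triple-ones<dim valid)))

rotation∩triple : ∀ {m r i j k f} → r < dim m → ValidTriple m i j k →
                  f ∈ʷ word m (rotation r) → f ∈ʷ word m (triple i j k) → ⊥
rotation∩triple {f = f} r<n valid f∈r f∈t with rotation-point r<n f∈r
... | t , t<n , _ , _ , zeroAt with Equivalence.to (tripleWord-char valid f) f∈t | triple-ones<dim valid
...   | (first , _) , (second , _) , (third , _) | i<n , P₂<n , P₃<n with Preceding-triple t t<n valid
...     | inj₁ pre        = clash first  (zeroAt _ i<n pre)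
...     | inj₂ (inj₁ pre) = clash second (zeroAt _ P₂<n pre)
...     | inj₂ (inj₂ pre) = clash third  (zeroAt _ P₃<n pre)

rotation∩rotation : ∀ {m r r′ f} → r < dim m → r′ < dim m →
                    f ∈ʷ word m (rotation r) → f ∈ʷ word m (rotation r′) → r ≡ r′
rotation∩rotation {m} r<n r′<n f∈r f∈r′ with rotation-point r<n f∈r | rotation-point r′<n f∈r′
... | t , t<n , one , ft , zeroAt | t′ , t′<n , one′ , ft′ , zeroAt′ with t ≟ t′
...   | yes refl = RotatedOne-injective r<n r′<n one one′
...   | no  t≢t′ with Preceding-total m t t′ t≢t′
...     | inj₁ pre = ⊥-elim (clash ft′ (zeroAt t′ t′<n pre))
...     | inj₂ pre = ⊥-elim (clash ft (zeroAt′ t t<n pre))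

triple∩triple : ∀ {m i j k i′ j′ k′ f} → ValidTriple m i j k → ValidTriple m i′ j′ k′ →
                f ∈ʷ word m (triple i j k) → f ∈ʷ word m (triple i′ j′ k′) → triple i j k ≡ triple i′ j′ k′
triple∩triple {f = f} valid valid′ f∈t f∈t′
  with Equivalence.to (tripleWord-char valid f) f∈t | Equivalence.to (tripleWord-char valid′ f) f∈t′
... | first , second , third | first′ , second′ , third′ with FirstTrue-unique first first′
...   | refl with FirstTrue-unique third third′
...     | refl with FirstTrue-unique second second′
...       | refl = refl

shared-point⇒≡ : ∀ m μ ν {f} → Valid m μ → Valid m ν → f ∈ʷ word m μ → f ∈ʷ word m ν → μ ≡ ν
shared-point⇒≡ m origin         origin         _ _ _ _ = refl
shared-point⇒≡ m origin         (rotation _)   _ v a b = ⊥-elim (origin∩rotation m v a b)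
shared-point⇒≡ m origin         (triple _ _ _) _ v a b = ⊥-elim (origin∩triple m v a b)
shared-point⇒≡ m (rotation _)   origin         v _ a b = ⊥-elim (origin∩rotation m v b a)
shared-point⇒≡ m (rotation _)   (rotation _)   v w a b = cong rotation (rotation∩rotation v w a b)
shared-point⇒≡ m (rotation _)   (triple _ _ _) v w a b = ⊥-elim (rotation∩triple v w a b)
shared-point⇒≡ m (triple _ _ _) origin         v _ a b = ⊥-elim (origin∩triple m v b a)
shared-point⇒≡ m (triple _ _ _) (rotation _)   v w a b = ⊥-elim (rotation∩triple w v b a)
shared-point⇒≡ m (triple _ _ _) (triple _ _ _) v w a b = triple∩triple v w a b

late-rotation : ∀ {m i f} → m ≤ i → FirstTrue f i → RotationPoint m i f
late-rotation {m} {i} {f} m≤i (fi , below) = fi , zeroAt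
  where
  zeroAt : ∀ p → p < dim m → Preceding m i p → f p ≡ false
  zeroAt p _   (inj₁ (p<i , _)) = below p p<i
  zeroAt p p<n (inj₂ i+m<p)     =
    ⊥-elim (<⇒≱ i+m<p (≤-trans (s≤s⁻¹ p<n) (subst (_≤ i + m) (sym (double m)) (+-monoˡ-≤ m m≤i))))

early-rotation : ∀ {m i f} → FirstTrue f i → Zeros (m ∸ i) (shift (i + suc m) f) → RotationPoint m i f
early-rotation {m} {i} {f} (fi , below) beyond = fi , zeroAt
  where
  zeroAt : ∀ p → p < dim m → Preceding m i p → f p ≡ false
  zeroAt p _   (inj₁ (p<i , _)) = below p p<i
  zeroAt p p<n (inj₂ i+m<p) with m≤n⇒∃[o]m+o≡n i+m<p
  ... | q , refl = subst (λ x → f x ≡ false) (cong (_+ q) (+-suc i m)) (beyond q (+<⇒<∸ i q i+q<m))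
    where
    regroup : ∀ i m q → i + m + q ≡ m + (i + q)
    regroup = solve-∀
    i+q<m : i + q < m
    i+q<m = +-cancelˡ-< m (i + q) m (subst₂ _<_ (regroup i m q) (double m) (s≤s⁻¹ p<n))

third-rotation : ∀ {m i j f} → FirstTrue (shift (i + suc m) f) j → Zeros (m ∸ j) (shift (i + suc j) f) →
                 RotationPoint m (i + suc m + j) f
third-rotation {m} {i} {j} {f} (fP₃ , below) between = fP₃ , zeroAt
  where
  zeroAt : ∀ p → p < dim m → Preceding m (i + suc m + j) p → f p ≡ false
  zeroAt p p<n (inj₁ (p<P₃ , P₃≤p+m)) with p <? i + suc m
  ... | yes p<i+1+m with m≤n⇒∃[o]m+o≡n (+-cancelʳ-≤ m (i + suc j) p (subst (_≤ p + m) (regroup i j m) P₃≤p+m))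
    where
    regroup : ∀ i j m → i + suc m + j ≡ i + suc j + m
    regroup = solve-∀
  ...   | q , refl = between q (+<⇒<∸ j q (+-cancelˡ-< (suc i) (j + q) m (subst₂ _<_ (regroup i j q) (+-suc i m) p<i+1+m)))
    where
    regroup : ∀ i j q → i + suc j + q ≡ suc i + (j + q)
    regroup = solve-∀
  zeroAt p p<n (inj₁ (p<P₃ , P₃≤p+m)) | no p≮i+1+m with m≤n⇒∃[o]m+o≡n (≮⇒≥ p≮i+1+m)
  ...   | q , refl = below q (+-cancelˡ-< (i + suc m) q j p<P₃)
  zeroAt p p<n (inj₂ P₃+m<p) = ⊥-elim (<⇒≱ P₃+m<p (≤-trans (<⇒≤ p<n) (≤-of-+ (dim m) (i + j) (regroup i j m))))
    where
    regroup : ∀ i j m → suc (2 * m) + (i + j) ≡ i + suc m + j + m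
    regroup = solve-∀

rotation-containing : ∀ {m t f} → t < dim m → RotationPoint m t f → Σ Code λ μ → Valid m μ × f ∈ʷ word m μ
rotation-containing {m} {t} {f} t<n point with rotation-at m t t<n
... | r , r<n , char = rotation r , r<n , Equivalence.from (char f) point

code-containing : ∀ m f → Σ Code λ μ → Valid m μ × f ∈ʷ word m μ
code-containing m f with first-true? f (dim m)
... | inj₁ zeros = origin , tt , Equivalence.from (∈ʷ-replicate (dim m)) (λ q q<n → false-O (zeros q q<n))
... | inj₂ (i , i<n , first) with m ≤? i
...   | yes m≤i = rotation-containing i<n (late-rotation m≤i first)
...   | no  m≰i with first-true? (shift (i + suc m) f) (m ∸ i)
...     | inj₁ beyond = rotation-containing i<n (early-rotation first beyond)
...     | inj₂ (j , j<m∸i , third) with first-true? (shift (i + suc j) f) (m ∸ j)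
...       | inj₁ between = rotation-containing (third<dim i j (<∸⇒+< (≰⇒> m≰i) j<m∸i)) (third-rotation third between)
...       | inj₂ (k , k<m∸j , second) =
  triple i j k , valid , Equivalence.from (tripleWord-char valid f) (first , second , third)
  where
  valid : ValidTriple m i j k
  valid = ≰⇒> m≰i , j<m∸i , k<m∸j

word-injective : ∀ m μ ν → Valid m μ → Valid m ν → word m μ ≡ word m ν → μ ≡ ν
word-injective m μ ν vμ vν eq =
  shared-point⇒≡ m μ ν vμ vν (corner-∈ʷ (word m μ)) (subst (corner (word m μ) ∈ʷ_) eq (corner-∈ʷ (word m μ)))

triplesFrom : ℕ → ℕ → List Word
triplesFrom m i = concatMap (λ j → map (tripleWord m i j) (upTo (m ∸ j))) (upTo (m ∸ i))

∈-rotations⁻ : ∀ m {w} → w ∈ rotations m → Σ ℕ λ r → r < dim m × w ≡ word m (rotation r)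
∈-rotations⁻ m w∈ = let r , r∈ , w≡ = ∈-map⁻ (λ r → rotate r (baseWord m)) w∈ in r , ∈-upTo⁻ r∈ , w≡

∈-triplesFrom⁻ : ∀ m i {w} → w ∈ triplesFrom m i →
                 Σ ℕ λ j → Σ ℕ λ k → j < m ∸ i × k < m ∸ j × w ≡ tripleWord m i j k
∈-triplesFrom⁻ m i w∈ =
  let j , j∈ , w∈j = find (∈-concatMap⁻ _ {xs = upTo (m ∸ i)} w∈)
      k , k∈ , w≡  = ∈-map⁻ (tripleWord m i j) w∈j
  in j , k , ∈-upTo⁻ j∈ , ∈-upTo⁻ k∈ , w≡

∈-triples⁻ : ∀ m {w} → w ∈ triples m →
             Σ ℕ λ i → Σ ℕ λ j → Σ ℕ λ k → ValidTriple m i j k × w ≡ word m (triple i j k)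
∈-triples⁻ m w∈ =
  let i , i∈ , w∈i = find (∈-concatMap⁻ (triplesFrom m) {xs = upTo m} w∈)
      j , k , j< , k< , w≡ = ∈-triplesFrom⁻ m i w∈i
  in i , j , k , (∈-upTo⁻ i∈ , j< , k<) , w≡

∈-family⁻ : ∀ m {w} → w ∈ family m → Σ Code λ μ → Valid m μ × w ≡ word m μ
∈-family⁻ m (here refl) = origin , tt , refl
∈-family⁻ m (there w∈) with ∈-++⁻ (rotations m) w∈
... | inj₁ w∈r = let r , r<n , w≡ = ∈-rotations⁻ m w∈r in rotation r , r<n , w≡
... | inj₂ w∈t = let i , j , k , valid , w≡ = ∈-triples⁻ m w∈t in triple i j k , valid , w≡

∈-family⁺ : ∀ m μ → Valid m μ → word m μ ∈ family m
∈-family⁺ m origin         _ = here refl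
∈-family⁺ m (rotation r)   r<n = there (∈-++⁺ˡ (∈-map⁺ _ (∈-upTo⁺ r<n)))
∈-family⁺ m (triple i j k) (i<m , j< , k<) = there (∈-++⁺ʳ (rotations m)
  (∈-concatMap⁺ _ (lose (∈-upTo⁺ i<m) (∈-concatMap⁺ _ (lose (∈-upTo⁺ j<) (∈-map⁺ _ (∈-upTo⁺ k<)))))))

triple-injective : ∀ {i j k i′ j′ k′} → triple i j k ≡ triple i′ j′ k′ → i ≡ i′ × j ≡ j′ × k ≡ k′
triple-injective refl = refl , refl , refl

rotations-unique : ∀ m → Unique (rotations m)
rotations-unique m = Unique-map⁺ same-r (Unique.upTo⁺ (dim m))
  where
  same-r : ∀ {r r′} → r ∈ upTo (dim m) → r′ ∈ upTo (dim m) → word m (rotation r) ≡ word m (rotation r′) → r ≡ r′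
  same-r {r} {r′} r∈ r′∈ eq with word-injective m (rotation r) (rotation r′) (∈-upTo⁻ r∈) (∈-upTo⁻ r′∈) eq
  ... | refl = refl

triplesFrom-unique : ∀ m {i} → i < m → Unique (triplesFrom m i)
triplesFrom-unique m {i} i<m =
  Unique-concatMap⁺ (Unique.upTo⁺ (m ∸ i)) (λ j∈ → Unique-map⁺ (same-k j∈) (Unique.upTo⁺ _)) same-j
  where
  valid : ∀ {j k} → j ∈ upTo (m ∸ i) → k ∈ upTo (m ∸ j) → ValidTriple m i j k
  valid j∈ k∈ = i<m , ∈-upTo⁻ j∈ , ∈-upTo⁻ k∈
  same-k : ∀ {j k k′} → j ∈ upTo (m ∸ i) → k ∈ upTo (m ∸ j) → k′ ∈ upTo (m ∸ j) →
           tripleWord m i j k ≡ tripleWord m i j k′ → k ≡ k′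
  same-k {j} {k} {k′} j∈ k∈ k′∈ eq =
    proj₂ (proj₂ (triple-injective (word-injective m (triple i j k) (triple i j k′) (valid j∈ k∈) (valid j∈ k′∈) eq)))
  same-j : ∀ {j j′ w} → j ∈ upTo (m ∸ i) → j′ ∈ upTo (m ∸ i) →
           w ∈ map (tripleWord m i j) (upTo (m ∸ j)) → w ∈ map (tripleWord m i j′) (upTo (m ∸ j′)) → j ≡ j′
  same-j {j} {j′} j∈ j′∈ w∈ w∈′ with ∈-map⁻ (tripleWord m i j) w∈ | ∈-map⁻ (tripleWord m i j′) w∈′
  ... | k , k∈ , refl | k′ , k′∈ , eq =
    proj₁ (proj₂ (triple-injective (word-injective m (triple i j k) (triple i j′ k′) (valid j∈ k∈) (valid j′∈ k′∈) eq)))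

triples-unique : ∀ m → Unique (triples m)
triples-unique m = Unique-concatMap⁺ (Unique.upTo⁺ m) (λ i∈ → triplesFrom-unique m (∈-upTo⁻ i∈)) same-i
  where
  same-i : ∀ {i i′ w} → i ∈ upTo m → i′ ∈ upTo m → w ∈ triplesFrom m i → w ∈ triplesFrom m i′ → i ≡ i′
  same-i {i} {i′} i∈ i′∈ w∈ w∈′ with ∈-triplesFrom⁻ m i w∈ | ∈-triplesFrom⁻ m i′ w∈′
  ... | j , k , j< , k< , refl | j′ , k′ , j′< , k′< , eq =
    proj₁ (triple-injective (word-injective m (triple i j k) (triple i′ j′ k′) (∈-upTo⁻ i∈ , j< , k<) (∈-upTo⁻ i′∈ , j′< , k′<) eq))

family-unique : ∀ m → Unique (family m)
family-unique m = All.tabulate origin-new ∷ Unique.++⁺ (rotations-unique m) (triples-unique m) rotations#triples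
  where
  origin-new : ∀ {w} → w ∈ rotations m ++ triples m → word m origin ≢ w
  origin-new w∈ eq with ∈-++⁻ (rotations m) w∈
  ... | inj₁ w∈r with ∈-rotations⁻ m w∈r
  ...   | r , r<n , refl with word-injective m origin (rotation r) tt r<n eq
  ...     | ()
  origin-new w∈ eq | inj₂ w∈t with ∈-triples⁻ m w∈t
  ...   | i , j , k , valid , refl with word-injective m origin (triple i j k) tt valid eq
  ...     | ()
  rotations#triples : ∀ {w} → w ∈ rotations m × w ∈ triples m → ⊥
  rotations#triples (w∈r , w∈t) with ∈-rotations⁻ m w∈r | ∈-triples⁻ m w∈t
  ... | r , r<n , refl | i , j , k , valid , eq with word-injective m (rotation r) (triple i j k) r<n valid eq
  ... | ()

member-code : ∀ m p → Σ Code λ μ → Valid m μ × lookup (family m) p ≡ word m μ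
member-code m p = ∈-family⁻ m (∈-lookup p)

member-length : ∀ m p → length (lookup (family m) p) ≡ dim m
member-length m p with member-code m p
... | μ , valid , eq = trans (cong length eq) (word-length m μ valid)

member-unique : ∀ m p q {f} → f ∈ʷ lookup (family m) p → f ∈ʷ lookup (family m) q → p ≡ q
member-unique m p q {f} f∈p f∈q with member-code m p | member-code m q
... | μ , vμ , eqμ | ν , vν , eqν =
  Unique-lookup-injective (family-unique m) p q
    (trans eqμ (trans (cong (word m) (shared-point⇒≡ m μ ν vμ vν (subst (f ∈ʷ_) eqμ f∈p) (subst (f ∈ʷ_) eqν f∈q)))
                      (sym eqν)))

family-partition : ∀ m → IsSubcubePartition (dim m) (family m)
family-partition m = All.tabulate length-of , cover
  where
  length-of : ∀ {w} → w ∈ family m → length w ≡ dim m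
  length-of w∈ with ∈-family⁻ m w∈
  ... | μ , valid , refl = word-length m μ valid
  cover : (x : Vec Bool (dim m)) → Σ (Fin (length (family m))) λ p →
          (x ∈ᶜ lookup (family m) p) × ((q : Fin (length (family m))) → x ∈ᶜ lookup (family m) q → q ≡ p)
  cover x with code-containing m (toPoint (toList x))
  ... | μ , valid , x∈μ = p , Equivalence.from (∈ᶜ⇔∈ʷ x _ (member-length m p)) x∈p ,
                          λ q x∈q → member-unique m q p (Equivalence.to (∈ᶜ⇔∈ʷ x _ (member-length m q)) x∈q) x∈p
    where
    μ∈ = ∈-family⁺ m μ valid
    p = Any.index μ∈
    x∈p : toPoint (toList x) ∈ʷ lookup (family m) p
    x∈p = subst (_ ∈ʷ_) (lookup-index μ∈) x∈μ

family-tight : ∀ m → Tight (dim m) (family m)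
family-tight m i = replicate (dim m) O , here refl , zeros-fixed (dim m) (toℕ i) (toℕ<n i)
  where
  zeros-fixed : ∀ n d → d < n → Fixed (replicate n O) d
  zeros-fixed (suc n) zero    _         = λ ()
  zeros-fixed (suc n) (suc d) (s≤s d<n) = zeros-fixed n d d<n

-- Irreducibility

pointwise-union : ∀ {n} F G s → (∀ p → length (lookup F p) ≡ n) → length s ≡ n →
  ((x : Vec Bool n) → (x ∈ᶜ s) ⇔ (Σ (Fin (length F)) λ p → p ∈ˢ G × x ∈ᶜ lookup F p)) →
  ∀ f → f ∈ʷ s ⇔ (Σ (Fin (length F)) λ p → p ∈ˢ G × f ∈ʷ lookup F p)
pointwise-union {n} F G s length-F length-s union f = mk⇔
  (λ f∈s → let p , p∈G , x∈p = Equivalence.to (union x) (Equivalence.from (fromPoint-∈ᶜ f s length-s) f∈s)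
           in p , p∈G , Equivalence.to (fromPoint-∈ᶜ f _ (length-F p)) x∈p)
  (λ (p , p∈G , f∈p) → Equivalence.to (fromPoint-∈ᶜ f s length-s)
           (Equivalence.from (union x) (p , p∈G , Equivalence.from (fromPoint-∈ᶜ f _ (length-F p)) f∈p)))
  where
  x = fromPoint n f

module Union {n} (F : List Word)
  (length-F : ∀ p → length (lookup F p) ≡ n)
  (disjoint : ∀ p q {f} → f ∈ʷ lookup F p → f ∈ʷ lookup F q → p ≡ q)
  (G : Subset (length F)) (s : Word) (length-s : length s ≡ n)
  (union : ∀ f → f ∈ʷ s ⇔ (Σ (Fin (length F)) λ p → p ∈ˢ G × f ∈ʷ lookup F p)) where

  owner : ∀ f → f ∈ʷ s → Σ (Fin (length F)) λ p → p ∈ˢ G × f ∈ʷ lookup F p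
  owner f = Equivalence.to (union f)

  member⊆s : ∀ {p} → p ∈ˢ G → ∀ f → f ∈ʷ lookup F p → f ∈ʷ s
  member⊆s p∈G f f∈p = Equivalence.from (union f) (_ , p∈G , f∈p)

  agree : ∀ {p} → p ∈ˢ G → ∀ d → at s d ≢ S → at (lookup F p) d ≡ at s d
  agree {p} p∈G = ⊆⇒agree (lookup F p) s (member⊆s p∈G)

  inside⇒∣G∣≤1 : ∀ p → (∀ f → f ∈ʷ s → f ∈ʷ lookup F p) → ∣ G ∣ ≤ 1
  inside⇒∣G∣≤1 p s⊆p = subst (∣ G ∣ ≤_) (∣⁅x⁆∣≡1 p) (p⊆q⇒∣p∣≤∣q∣ G⊆⁅p⁆)
    where
    G⊆⁅p⁆ : G ⊆ˢ ⁅ p ⁆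
    G⊆⁅p⁆ {q} q∈G = subst (_∈ˢ ⁅ p ⁆)
      (sym (disjoint q p (corner-∈ʷ (lookup F q)) (s⊆p _ (member⊆s q∈G _ (corner-∈ʷ (lookup F q)))))) (x∈⁅x⁆ p)

  stars⇒∣F∣≤∣G∣ : (∀ d → d < n → at s d ≡ S) → length F ≤ ∣ G ∣
  stars⇒∣F∣≤∣G∣ stars = subst (_≤ ∣ G ∣) (∣⊤∣≡n (length F)) (p⊆q⇒∣p∣≤∣q∣ full⊆G)
    where
    corner∈s : ∀ q → corner (lookup F q) ∈ʷ s
    corner∈s q d d<s = subst (Match _) (sym (stars d (subst (d <_) length-s d<s))) (match-S _)
    full⊆G : full ⊆ˢ G
    full⊆G {q} _ with owner _ (corner∈s q)
    ... | p , p∈G , corner∈p = subst (_∈ˢ G) (disjoint p q corner∈p (corner-∈ʷ (lookup F q))) p∈G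

  private
    corner-owner = owner (corner s) (corner-∈ʷ s)

  a : Fin (length F)
  a = proj₁ corner-owner

  a∈G : a ∈ˢ G
  a∈G = proj₁ (proj₂ corner-owner)

  corner∈a : corner s ∈ʷ lookup F a
  corner∈a = proj₂ (proj₂ corner-owner)

  -- b is the member containing the corner of s raised at c.
  star-splits : ∀ c → at s c ≡ S → at (lookup F a) c ≢ S →
    Σ (Fin (length F)) λ b → b ∈ˢ G × at (lookup F b) c ≡ I × ones (lookup F b) ≡ suc (ones (lookup F a))
  star-splits c sc≡S ac≢S =
    b , b∈G , bc≡I , ones-insert A B c (trans (length-F a) (sym (length-F b))) ac≢I bc≡I same-ones
    where
    A = lookup F a
    y = corner s
    z = y [ c ]≔ true
    yc≡false : y c ≡ false
    yc≡false = cong isI sc≡S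
    z∈s : z ∈ʷ s
    z∈s = ∈ʷ-[]≔ s c (subst (Match true) (sym sc≡S) tt) (corner-∈ʷ s)
    b = proj₁ (owner z z∈s)
    b∈G = proj₁ (proj₂ (owner z z∈s))
    z∈b = proj₂ (proj₂ (owner z z∈s))
    B = lookup F b
    z≗y : ∀ d → d ≢ c → z d ≡ y d
    z≗y d d≢c = []≔-other y c true d d≢c
    ac≢I : at A c ≢ I
    ac≢I eq = clash (∈ʷ-at-I A c corner∈a eq) yc≡false
    bc≢O : at B c ≢ O
    bc≢O eq = clash ([]≔-same y c true) (∈ʷ-at-O B c z∈b eq)
    bc≢S : at B c ≢ S
    bc≢S eq = ac≢S (subst (λ p → at (lookup F p) c ≡ S) (disjoint b a y∈B corner∈a) eq)
      where
      y∈B : y ∈ʷ B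
      y∈B = ∈ʷ-resp-≗ B (λ d _ → []≔-revert y c true d)
                        (∈ʷ-[]≔ B c (subst (Match (y c)) (sym eq) (match-S (y c))) z∈b)
    bc≡I : at B c ≡ I
    bc≡I = ≢O≢S⇒I bc≢O bc≢S
    same-ones : ∀ d → d ≢ c → at A d ≡ I ⇔ at B d ≡ I
    same-ones d d≢c = mk⇔
      (λ ad≡I → let sd≡I = corner-true s d (∈ʷ-at-I A d corner∈a ad≡I)
                in trans (agree b∈G d (I⇒≢S sd≡I)) sd≡I)
      (λ bd≡I → let sd≡I = corner-true s d (trans (sym (z≗y d d≢c)) (∈ʷ-at-I B d z∈b bd≡I))
                in trans (agree a∈G d (I⇒≢S sd≡I)) sd≡I)

  stars-kept⇒s⊆a : (∀ d → d < n → at s d ≡ S → at (lookup F a) d ≡ S) → ∀ f → f ∈ʷ s → f ∈ʷ lookup F a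
  stars-kept⇒s⊆a kept f f∈s d d<A with at s d ≟S
  ... | yes sd≡S = subst (Match (f d)) (sym (kept d (subst (d <_) (length-F a) d<A) sd≡S)) (match-S (f d))
  ... | no  sd≢S = subst (Match (f d)) (sym (agree a∈G d sd≢S))
                         (f∈s d (subst (d <_) (trans (length-F a) (sym length-s)) d<A))

weight-step : ∀ μ ν → weight ν ≡ suc (weight μ) → μ ≡ origin × Σ ℕ λ r → ν ≡ rotation r
weight-step origin         (rotation r)   _  = refl , r , refl
weight-step origin         origin         ()
weight-step origin         (triple _ _ _) ()
weight-step (rotation _)   origin         ()
weight-step (rotation _)   (rotation _)   ()
weight-step (rotation _)   (triple _ _ _) ()
weight-step (triple _ _ _) origin         ()
weight-step (triple _ _ _) (rotation _)   ()
weight-step (triple _ _ _) (triple _ _ _) ()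

one-more-one : ∀ m p q → ones (lookup (family m) q) ≡ suc (ones (lookup (family m) p)) →
  lookup (family m) p ≡ word m origin × Σ ℕ λ r → r < dim m × lookup (family m) q ≡ word m (rotation r)
one-more-one m p q more with member-code m p | member-code m q
... | μ , _ , eqμ | ν , vν , eqν with weight-step μ ν (trans (sym (ones-word m ν)) (trans (cong ones (sym eqν))
                                                          (trans more (cong suc (trans (cong ones eqμ) (ones-word m μ))))))
...   | refl , r , refl = eqμ , r , vν , eqν

rotation-member-star : ∀ m r {w} → r < dim m → w ≡ word m (rotation r) → ∀ c → at w c ≡ I →
                       ∀ p → p < dim m → p ≢ c → ¬ Preceding m c p → at w p ≡ S
rotation-member-star m r r<n refl c wc≡I p p<n p≢c ¬pre with rotation-char m r r<n
... | t , _ , _ , char with rotation-one {w = word m (rotation r)} char c wc≡I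
...   | refl = rotation-star {w = word m (rotation r)} char p (subst (p <_) (sym (word-length m (rotation r) r<n)) p<n)
                             p≢c ¬pre

module FamilyUnion (m : ℕ) (G : Subset (length (family m))) (s : Word) (length-s : length s ≡ dim m)
  (union : ∀ f → f ∈ʷ s ⇔ (Σ (Fin (length (family m))) λ p → p ∈ˢ G × f ∈ʷ lookup (family m) p)) where

  open Union (family m) (member-length m) (member-unique m) G s length-s union public

  A : Word
  A = lookup (family m) a

  split⇒rotation : ∀ c → at s c ≡ S → at A c ≢ S →
    lookup (family m) a ≡ word m origin ×
    Σ (Fin (length (family m))) λ b → b ∈ˢ G × at (lookup (family m) b) c ≡ I ×
      Σ ℕ λ r → r < dim m × lookup (family m) b ≡ word m (rotation r)
  split⇒rotation c sc≡S ac≢S =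
    let b , b∈G , bc≡I , more = star-splits c sc≡S ac≢S
        A≡ , r , r<n , B≡ = one-more-one m a b more
    in A≡ , b , b∈G , bc≡I , r , r<n , B≡

  star-spreads : (∀ d → d < dim m → at A d ≡ O) → ∀ c → c < dim m → at s c ≡ S →
                 ∀ p → p < dim m → p ≢ c → ¬ Preceding m c p → at s p ≡ S
  star-spreads zeros c c<n sc≡S p p<n p≢c ¬pre with at s p ≟S
  ... | yes sp≡S = sp≡S
  ... | no  sp≢S =
    let _ , b , b∈G , bc≡I , r , r<n , B≡ = split⇒rotation c sc≡S (O⇒≢S (zeros c c<n))
    in ⊥-elim (sp≢S (trans (sym (agree b∈G p sp≢S)) (rotation-member-star m r r<n B≡ c bc≡I p p<n p≢c ¬pre)))

  proper-union-impossible : 1 ≤ m → 1 < ∣ G ∣ → ∣ G ∣ < length (family m) → ⊥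
  proper-union-impossible 1≤m 1<∣G∣ ∣G∣<∣F∣ with anyUpTo? (λ c → (at s c ≟S) ×-dec ¬? (at A c ≟S)) (dim m)
  ... | no none = <⇒≱ 1<∣G∣ (inside⇒∣G∣≤1 a (stars-kept⇒s⊆a kept))
    where
    kept : ∀ d → d < dim m → at s d ≡ S → at A d ≡ S
    kept d d<n sd≡S with at A d ≟S
    ... | yes ad≡S = ad≡S
    ... | no  ad≢S = ⊥-elim (none (d , d<n , sd≡S , ad≢S))
  ... | yes (c , c<n , sc≡S , ac≢S) = <⇒≱ ∣G∣<∣F∣ (stars⇒∣F∣≤∣G∣ all-stars)
    where
    zeros : ∀ d → d < dim m → at A d ≡ O
    zeros d d<n = trans (cong (λ w → at w d) (proj₁ (split⇒rotation c sc≡S ac≢S))) (at-replicate (dim m) O d d<n)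
    step : ∀ e → suc e ≤ 2 * m → at s e ≡ S → at s (suc e) ≡ S
    step e e<2m se≡S = star-spreads zeros e (m<n⇒m<1+n e<2m) se≡S (suc e) (s≤s e<2m) 1+n≢n (¬Preceding-suc e 1≤m)
    wrap : at s (2 * m) ≡ S → at s 0 ≡ S
    wrap s2m≡S =
      star-spreads zeros (2 * m) ≤-refl s2m≡S 0 (s≤s z≤n) (<⇒≢ (≤-trans 1≤m (m≤m+n m _))) (¬Preceding-0 1≤m)
    all-stars : ∀ d → d < dim m → at s d ≡ S
    all-stars d d<n = cyclic-spread (2 * m) step wrap c (s≤s⁻¹ c<n) sc≡S d (s≤s⁻¹ d<n)

family-irreducible : ∀ m → 1 ≤ m → Irreducible (dim m) (family m)
family-irreducible m 1≤m G 1<∣G∣ ∣G∣<∣F∣ (s , length-s , union) =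
  FamilyUnion.proper-union-impossible m G s length-s (pointwise-union (family m) G s (member-length m) length-s union)
    1≤m 1<∣G∣ ∣G∣<∣F∣

-- Size

staircase : ℕ → ℕ → ℕ
staircase m a = sum (map (m ∸_) (upTo a))

staircase-suc : ∀ m a → staircase (suc m) (suc a) ≡ suc m + staircase m a
staircase-suc m a = cong (suc m +_) (cong sum (trans (map-applyUpTo suc (suc m ∸_) a) (sym (map-applyUpTo (λ j → j) (m ∸_) a))))

staircase-lower : ∀ a m → a ≤ m → a * suc m ≤ 2 * staircase m a
staircase-lower zero    m       _         = z≤n
staircase-lower (suc a) (suc m) (s≤s a≤m) = begin
  suc a * suc (suc m)                 ≡⟨ expand a m ⟩
  a * suc m + (a + suc (suc m))        ≤⟨ +-mono-≤ (staircase-lower a m a≤m) (+-monoˡ-≤ (suc (suc m)) a≤m) ⟩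
  2 * staircase m a + (m + suc (suc m)) ≡⟨ collect m (staircase m a) ⟩
  2 * (suc m + staircase m a)         ≡⟨ cong (2 *_) (sym (staircase-suc m a)) ⟩
  2 * staircase (suc m) (suc a)       ∎
  where
  open ≤-Reasoning
  expand : ∀ a m → suc a * suc (suc m) ≡ a * suc m + (a + suc (suc m))
  expand = solve-∀
  collect : ∀ m s → 2 * s + (m + suc (suc m)) ≡ 2 * (suc m + s)
  collect = solve-∀

tripleCount : ℕ → ℕ
tripleCount m = sum (map (λ i → staircase m (m ∸ i)) (upTo m))

length-triples : ∀ m → length (triples m) ≡ tripleCount m
length-triples m = trans (length-concatMap (triplesFrom m) (upTo m)) (cong sum (map-cong length-triplesFrom (upTo m)))
  where
  length-triplesFrom : ∀ i → length (triplesFrom m i) ≡ staircase m (m ∸ i)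
  length-triplesFrom i = trans (length-concatMap _ (upTo (m ∸ i)))
    (cong sum (map-cong (λ j → trans (length-map (tripleWord m i j) (upTo (m ∸ j))) (length-upTo (m ∸ j))) (upTo (m ∸ i))))

length-family : ∀ m → length (family m) ≡ suc (dim m + tripleCount m)
length-family m = cong suc (trans (length-++ (rotations m))
  (cong₂ _+_ (trans (length-map _ (upTo (dim m))) (length-upTo (dim m))) (length-triples m)))

tripleCount-lower : ∀ m → m * suc m * suc m ≤ 4 * tripleCount m
tripleCount-lower m = begin
  m * suc m * suc m                                   ≡⟨ reorder m ⟩
  suc m * (m * suc m)                                 ≤⟨ *-monoʳ-≤ (suc m) (staircase-lower m m ≤-refl) ⟩
  suc m * (2 * staircase m m)                         ≡⟨ swap (suc m) (staircase m m) ⟩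
  2 * (suc m * staircase m m)                         ≡⟨ cong (2 *_) (sym (sum-map-*ˡ (suc m) (m ∸_) (upTo m))) ⟩
  2 * sum (map (λ i → suc m * (m ∸ i)) (upTo m))      ≤⟨ *-monoʳ-≤ 2 (sum-map-mono (upTo m) column) ⟩
  2 * sum (map (λ i → 2 * staircase m (m ∸ i)) (upTo m)) ≡⟨ cong (2 *_) (sum-map-*ˡ 2 (λ i → staircase m (m ∸ i)) (upTo m)) ⟩
  2 * (2 * tripleCount m)                             ≡⟨ double-double (tripleCount m) ⟩
  4 * tripleCount m                                   ∎
  where
  open ≤-Reasoning
  column : ∀ i → suc m * (m ∸ i) ≤ 2 * staircase m (m ∸ i)
  column i = subst (_≤ 2 * staircase m (m ∸ i)) (*-comm (m ∸ i) (suc m)) (staircase-lower (m ∸ i) m (m∸n≤m m i))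
  reorder : ∀ m → m * suc m * suc m ≡ suc m * (m * suc m)
  reorder = solve-∀
  swap : ∀ a b → a * (2 * b) ≡ 2 * (a * b)
  swap = solve-∀
  double-double : ∀ t → 2 * (2 * t) ≡ 4 * t
  double-double = solve-∀

tripleCount-upper : ∀ m → tripleCount m ≤ m * (m * m)
tripleCount-upper m = begin
  tripleCount m                       ≤⟨ sum-map-≤ (m * m) (upTo m) column ⟩
  length (upTo m) * (m * m)           ≡⟨ cong (_* (m * m)) (length-upTo m) ⟩
  m * (m * m)                         ∎
  where
  open ≤-Reasoning
  column : ∀ i → staircase m (m ∸ i) ≤ m * m
  column i = ≤-trans (sum-map-≤ m (upTo (m ∸ i)) (m∸n≤m m))
                     (≤-trans (≤-reflexive (cong (_* m) (length-upTo (m ∸ i)))) (*-monoˡ-≤ m (m∸n≤m m i)))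

dim≤4* : ∀ m → 1 ≤ m → dim m ≤ 4 * m
dim≤4* (suc k) _ = ≤-of-+ (dim (suc k)) (2 * k + 1) (split k)
  where
  split : ∀ k → suc (2 * suc k) + (2 * k + 1) ≡ 4 * suc k
  split = solve-∀

size-lower : ∀ m → 1 ≤ m → dim m ^ 3 ≤ 64 * size (family m)
size-lower m 1≤m = begin
  dim m ^ 3                                  ≡⟨ cube (dim m) ⟩
  dim m * (dim m * dim m)                    ≤⟨ *-mono-≤ n≤4m (*-mono-≤ n≤2m+2 n≤2m+2) ⟩
  (4 * m) * ((2 * suc m) * (2 * suc m))      ≡⟨ regroup m ⟩
  16 * (m * suc m * suc m)                   ≤⟨ *-monoʳ-≤ 16 (tripleCount-lower m) ⟩
  16 * (4 * tripleCount m)                   ≤⟨ *-monoʳ-≤ 16 (*-monoʳ-≤ 4 (≤-trans (m≤n+m (tripleCount m) (dim m)) (n≤1+n _))) ⟩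
  16 * (4 * suc (dim m + tripleCount m))     ≡⟨ times64 (suc (dim m + tripleCount m)) ⟩
  64 * suc (dim m + tripleCount m)           ≡⟨ cong (64 *_) (sym (length-family m)) ⟩
  64 * size (family m)                       ∎
  where
  open ≤-Reasoning
  cube : ∀ x → x ^ 3 ≡ x * (x * x)
  cube x = cong (λ z → x * (x * z)) (*-identityʳ x)
  regroup : ∀ m → (4 * m) * ((2 * suc m) * (2 * suc m)) ≡ 16 * (m * suc m * suc m)
  regroup = solve-∀
  times64 : ∀ t → 16 * (4 * t) ≡ 64 * t
  times64 = solve-∀
  n≤2m+2 : dim m ≤ 2 * suc m
  n≤2m+2 = ≤-of-+ (dim m) 1 (plus-one m)
    where
    plus-one : ∀ m → suc (2 * m) + 1 ≡ 2 * suc m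
    plus-one = solve-∀
  n≤4m : dim m ≤ 4 * m
  n≤4m = dim≤4* m 1≤m

size-upper : ∀ m → size (family m) ≤ 64 * dim m ^ 3
size-upper m = begin
  size (family m)                     ≡⟨ length-family m ⟩
  suc (dim m + tripleCount m)         ≤⟨ s≤s (+-monoʳ-≤ (dim m) (tripleCount-upper m)) ⟩
  1 + (dim m + m * (m * m))           ≤⟨ +-mono-≤ 1≤n³ (+-mono-≤ n≤n³ m³≤n³) ⟩
  n³ + (n³ + n³)                      ≤⟨ ≤-of-+ (n³ + (n³ + n³)) (61 * n³) (times64 n³) ⟩
  64 * n³                             ∎
  where
  open ≤-Reasoning
  n³ = dim m ^ 3
  times64 : ∀ y → y + (y + y) + 61 * y ≡ 64 * y
  times64 = solve-∀
  cube : dim m ^ 3 ≡ dim m * (dim m * dim m)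
  cube = cong (λ z → dim m * (dim m * z)) (*-identityʳ (dim m))
  m≤n : m ≤ dim m
  m≤n = ≤-trans (m≤m+n m (m + 0)) (n≤1+n _)
  1≤n : 1 ≤ dim m
  1≤n = s≤s z≤n
  n≤n³ : dim m ≤ n³
  n≤n³ = subst (dim m ≤_) (sym cube)
         (subst (_≤ dim m * (dim m * dim m)) (*-identityʳ (dim m)) (*-monoʳ-≤ (dim m) (*-mono-≤ 1≤n 1≤n)))
  1≤n³ : 1 ≤ n³
  1≤n³ = ≤-trans 1≤n n≤n³
  m³≤n³ : m * (m * m) ≤ n³
  m³≤n³ = subst (m * (m * m) ≤_) (sym cube) (*-mono-≤ m≤n (*-mono-≤ m≤n m≤n))

theorem2p8 : Σ ℕ λ C → (0 < C) × ((m : ℕ) → 1 ≤ m → IsSubcubePartition (suc (2 * m)) (family m) × Irreducible (suc (2 * m)) (family m) × Tight (suc (2 * m)) (family m) × (suc (2 * m) ^ 3 ≤ C * size (family m)) × (size (family m) ≤ C * suc (2 * m) ^ 3))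
theorem2p8 = 64 , s≤s z≤n , λ m 1≤m →
  family-partition m , family-irreducible m 1≤m , family-tight m , size-lower m 1≤m , size-upper m
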